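{- For each positive integer $e$ there exists $N$ such that for all integers $n > N$, \[ \mathcal C_e(\mathsf U_n) = \left\{ \left(\overline{a_2}^{(e)},\overline{a_3}^{(e)},\dots,\overline{a_e}^{(e)}\right) : a_i \in \mathbb Z \text{ and } 2^{i-1} \text{ divides } a_i \text{ for each } i = 2,\dots,e \right\}. \]
   Context: For $a\in\mathbb Z$ and a positive integer $e$, $\overline{a}^{(e)}$ denotes the residue class of $a$ modulo $2^e$. $\mathsf U_n$ is the set of $n\times n$ matrices with all entries in $\{1,-1\}$ and all diagonal entries equal to $1$. For a set $\mathsf M_n$ of $n\times n$ integer matrices, $\mathcal C_e(\mathsf M_n)$ is the set of tuples $\left(\overline{a_2}^{(e)},\dots,\overline{a_e}^{(e)}\right)$ such that $\det(xI-M)=\sum_{i=0}^n a_i x^{n-i}$ for some $M\in\mathsf M_n$ (with $a_i:=0$ for $i>n$). -}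

module Defs where

open import Data.Nat as ℕ using (ℕ; zero; suc; _∸_; _≤_; _<_)
open import Data.Integer as ℤ using (ℤ; +_; -_; _+_; _*_; _-_; 0ℤ; 1ℤ)
open import Data.Integer.Divisibility using (_∣_)
open import Data.Fin using (Fin; zero; suc; punchIn; _≟_)
open import Data.List using (List; []; _∷_)
open import Data.Product using (Σ; ∃; _×_)
open import Data.Sum using (_⊎_)
open import Relation.Binary.PropositionalEquality using (_≡_)
open import Relation.Nullary using (yes; no)
open import Relation.Nullary.Decidable using (⌊_⌋)
open import Data.Bool using (if_then_else_)

-- Polynomials in ℤ[x] as coefficient lists, lowest degree first.

Poly : Set
Poly = List ℤ

infixl 6 _+ₚ_
_+ₚ_ : Poly → Poly → Poly
[] +ₚ q = q
(a ∷ p) +ₚ [] = a ∷ p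
(a ∷ p) +ₚ (b ∷ q) = (a + b) ∷ (p +ₚ q)

scaleₚ : ℤ → Poly → Poly
scaleₚ c [] = []
scaleₚ c (a ∷ p) = (c * a) ∷ scaleₚ c p

infixl 7 _*ₚ_
_*ₚ_ : Poly → Poly → Poly
[] *ₚ q = []
(a ∷ p) *ₚ q = scaleₚ a q +ₚ (0ℤ ∷ (p *ₚ q))

coeff : Poly → ℕ → ℤ
coeff [] k = 0ℤ
coeff (a ∷ p) zero = a
coeff (a ∷ p) (suc k) = coeff p k

Matrix : Set → ℕ → Set
Matrix A n = Fin n → Fin n → A

sumFin : ∀ {n} → (Fin n → Poly) → Poly
sumFin {zero} f = []
sumFin {suc n} f = f zero +ₚ sumFin (λ j → f (suc j))

sign : ℕ → ℤ
sign zero = 1ℤ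
sign (suc k) = - sign k

finToℕ : ∀ {n} → Fin n → ℕ
finToℕ zero = zero
finToℕ (suc i) = suc (finToℕ i)

detₚ : ∀ n → Matrix Poly n → Poly
detₚ zero A = 1ℤ ∷ []
detₚ (suc n) A =
  sumFin (λ j → scaleₚ (sign (finToℕ j))
                   (A zero j *ₚ detₚ n (λ r c → A (suc r) (punchIn j c))))

charPoly : ∀ n → Matrix ℤ n → Poly
charPoly n M = detₚ n (λ i j →
  if ⌊ i ≟ j ⌋ then (- M i j) ∷ 1ℤ ∷ [] else (- M i j) ∷ [])

-- a_i where det(xI - M) = Σ_{i=0}^n a_i x^{n-i}, and a_i = 0 for i > n
charCoeff : ∀ n → Matrix ℤ n → ℕ → ℤ
charCoeff n M i with i ℕ.≤? n
... | yes _ = coeff (charPoly n M) (n ∸ i)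
... | no _ = 0ℤ

U : ∀ n → Matrix ℤ n → Set
U n M = (∀ i j → M i j ≡ 1ℤ ⊎ M i j ≡ - 1ℤ) × (∀ i → M i i ≡ 1ℤ)

_≡_[mod_] : ℤ → ℤ → ℤ → Set
a ≡ b [mod m ] = m ∣ (a - b)

pow2 : ℕ → ℤ
pow2 k = + (2 ℕ.^ k)

SameResidues : ℕ → (ℕ → ℤ) → (ℕ → ℤ) → Set
SameResidues e a t = ∀ i → 2 ≤ i → i ≤ e → a i ≡ t i [mod pow2 e ]

-- C_e(U_n) contains the residue tuple represented by t
InCU : ℕ → ℕ → (ℕ → ℤ) → Set
InCU e n t = Σ (Matrix ℤ n) λ M → U n M × SameResidues e (charCoeff n M) t

-- the right-hand set contains the residue tuple represented by t
InRHS : ℕ → (ℕ → ℤ) → Set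
InRHS e t = Σ (ℕ → ℤ) λ a →
  (∀ i → 2 ≤ i → i ≤ e → pow2 (i ∸ 1) ∣ a i) × SameResidues e a t

-- Necessity: the rows of a matrix M in U_n agree modulo 2, so subtracting the first row of xI − M
-- from the others leaves rows whose constant terms are even. Expanding the determinant, 2^(n−1−j)
-- divides the coefficient of x^j, that is, 2^(i−1) divides a_i.
--
-- Sufficiency: let M_β be the all-ones matrix whose entry (a, a+1) is negated when the bit β a is
-- set. Expanding det(xI − M_β) along the first row gives a three-term recursion in the size, and it
-- follows that prepending a bit to β changes a_k (1 ≤ k ≤ size) by −(−2)^(k−1) when the first k−1
-- bits of the new sequence are all set, and leaves it unchanged otherwise. So prepending the block
-- 0 1^(L+1) changes a_(L+2) by ±2^(L+1) and fixes every a_k with k > L+2. Since the current and the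
-- target value of a_(L+2) are both multiples of 2^(L+1) (the first by necessity), fewer than 2^e
-- blocks make them agree modulo 2^e; doing this for a_e, a_(e−1), …, a_2 in turn and then prepending
-- zeros, which fixes a_k for k ≥ 2, realises the target in every size n beyond a bound depending
-- only on e.

module Submission where

open import Defs
open import Algebra.Bundles using (CommutativeRing)
open import Data.Nat using (ℕ; suc; _≤_; _<_)
open import Data.Integer using (ℤ)
open import Data.Product using (Σ; _,_)
open import Function.Bundles using (_⇔_; mk⇔)

module Polynomial where
  open import Data.Nat using (zero; suc)
  open import Data.Integer using (_+_; _*_; -_; 0ℤ; 1ℤ)
  import Data.Integer.Properties as ℤ
  open import Data.List using ([]; _∷_)
  open import Level using (0ℓ)
  open import Relation.Binary.PropositionalEquality
  open import Relation.Binary.Bundles using (Setoid)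
  open import Relation.Binary.Structures using (IsEquivalence)
  import Relation.Binary.Reasoning.Setoid

  infix 4 _≈ₚ_
  record _≈ₚ_ (p q : Poly) : Set where
    constructor coeffwise
    field coeff-≡ : ∀ k → coeff p k ≡ coeff q k
  open _≈ₚ_ public

  -ₚ_ : Poly → Poly
  -ₚ p = scaleₚ (- 1ℤ) p

  0ₚ 1ₚ Xₚ : Poly
  0ₚ = []
  1ₚ = 1ℤ ∷ []
  Xₚ = 0ℤ ∷ 1ℤ ∷ []

  ≈ₚ-refl : ∀ {p} → p ≈ₚ p
  ≈ₚ-refl = coeffwise λ _ → refl

  ≈ₚ-sym : ∀ {p q} → p ≈ₚ q → q ≈ₚ p
  ≈ₚ-sym p≈q = coeffwise λ k → sym (coeff-≡ p≈q k)

  ≈ₚ-trans : ∀ {p q r} → p ≈ₚ q → q ≈ₚ r → p ≈ₚ r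
  ≈ₚ-trans p≈q q≈r = coeffwise λ k → trans (coeff-≡ p≈q k) (coeff-≡ q≈r k)

  ≈ₚ-isEquivalence : IsEquivalence _≈ₚ_
  ≈ₚ-isEquivalence = record { refl = ≈ₚ-refl ; sym = ≈ₚ-sym ; trans = ≈ₚ-trans }

  ≈ₚ-setoid : Setoid 0ℓ 0ℓ
  ≈ₚ-setoid = record { isEquivalence = ≈ₚ-isEquivalence }

  module ≈ₚ-Reasoning = Relation.Binary.Reasoning.Setoid ≈ₚ-setoid

  ≡⇒≈ₚ : ∀ {p q} → p ≡ q → p ≈ₚ q
  ≡⇒≈ₚ refl = ≈ₚ-refl

  ∷-cong : ∀ {a b p q} → a ≡ b → p ≈ₚ q → a ∷ p ≈ₚ b ∷ q
  ∷-cong a≡b p≈q = coeffwise λ { zero → a≡b ; (suc k) → coeff-≡ p≈q k }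

  ∷-≈0ₚ : ∀ {a p} → a ≡ 0ℤ → p ≈ₚ 0ₚ → a ∷ p ≈ₚ 0ₚ
  ∷-≈0ₚ a≡0 p≈0 = coeffwise λ { zero → a≡0 ; (suc k) → coeff-≡ p≈0 k }

  coeff-+ₚ : ∀ p q k → coeff (p +ₚ q) k ≡ coeff p k + coeff q k
  coeff-+ₚ []      q       k       = sym (ℤ.+-identityˡ _)
  coeff-+ₚ (a ∷ p) []      k       = sym (ℤ.+-identityʳ _)
  coeff-+ₚ (a ∷ p) (b ∷ q) zero    = refl
  coeff-+ₚ (a ∷ p) (b ∷ q) (suc k) = coeff-+ₚ p q k

  coeff-scaleₚ : ∀ c p k → coeff (scaleₚ c p) k ≡ c * coeff p k
  coeff-scaleₚ c []      k       = sym (ℤ.*-zeroʳ c)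
  coeff-scaleₚ c (a ∷ p) zero    = refl
  coeff-scaleₚ c (a ∷ p) (suc k) = coeff-scaleₚ c p k

  coeff-negₚ : ∀ p k → coeff (-ₚ p) k ≡ - coeff p k
  coeff-negₚ p k = trans (coeff-scaleₚ (- 1ℤ) p k) (ℤ.-1*i≡-i (coeff p k))

  +ₚ-cong : ∀ {p p′ q q′} → p ≈ₚ p′ → q ≈ₚ q′ → p +ₚ q ≈ₚ p′ +ₚ q′
  +ₚ-cong {p} {p′} {q} {q′} p≈p′ q≈q′ = coeffwise λ k → begin
    coeff (p +ₚ q) k         ≡⟨ coeff-+ₚ p q k ⟩
    coeff p k + coeff q k    ≡⟨ cong₂ _+_ (coeff-≡ p≈p′ k) (coeff-≡ q≈q′ k) ⟩
    coeff p′ k + coeff q′ k  ≡⟨ coeff-+ₚ p′ q′ k ⟨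
    coeff (p′ +ₚ q′) k       ∎
    where open ≡-Reasoning

  scaleₚ-cong : ∀ c {p q} → p ≈ₚ q → scaleₚ c p ≈ₚ scaleₚ c q
  scaleₚ-cong c {p} {q} p≈q = coeffwise λ k → begin
    coeff (scaleₚ c p) k  ≡⟨ coeff-scaleₚ c p k ⟩
    c * coeff p k         ≡⟨ cong (c *_) (coeff-≡ p≈q k) ⟩
    c * coeff q k         ≡⟨ coeff-scaleₚ c q k ⟨
    coeff (scaleₚ c q) k  ∎
    where open ≡-Reasoning

  +ₚ-assoc : ∀ p q r → (p +ₚ q) +ₚ r ≡ p +ₚ (q +ₚ r)
  +ₚ-assoc []      q       r       = refl
  +ₚ-assoc (a ∷ p) []      r       = refl
  +ₚ-assoc (a ∷ p) (b ∷ q) []      = refl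
  +ₚ-assoc (a ∷ p) (b ∷ q) (c ∷ r) = cong₂ _∷_ (ℤ.+-assoc a b c) (+ₚ-assoc p q r)

  +ₚ-comm : ∀ p q → p +ₚ q ≡ q +ₚ p
  +ₚ-comm []      []      = refl
  +ₚ-comm []      (b ∷ q) = refl
  +ₚ-comm (a ∷ p) []      = refl
  +ₚ-comm (a ∷ p) (b ∷ q) = cong₂ _∷_ (ℤ.+-comm a b) (+ₚ-comm p q)

  +ₚ-identityʳ : ∀ p → p +ₚ 0ₚ ≡ p
  +ₚ-identityʳ []      = refl
  +ₚ-identityʳ (a ∷ p) = refl

  -ₚ‿inverseʳ : ∀ p → p +ₚ -ₚ p ≈ₚ 0ₚ
  -ₚ‿inverseʳ []      = ≈ₚ-refl
  -ₚ‿inverseʳ (a ∷ p) =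
    ∷-≈0ₚ (trans (cong (a +_) (ℤ.-1*i≡-i a)) (ℤ.+-inverseʳ a)) (-ₚ‿inverseʳ p)

  -ₚ‿inverseˡ : ∀ p → -ₚ p +ₚ p ≈ₚ 0ₚ
  -ₚ‿inverseˡ p = ≈ₚ-trans (≡⇒≈ₚ (+ₚ-comm (-ₚ p) p)) (-ₚ‿inverseʳ p)

  scaleₚ-distrib-+ₚ : ∀ c p q → scaleₚ c (p +ₚ q) ≡ scaleₚ c p +ₚ scaleₚ c q
  scaleₚ-distrib-+ₚ c []      q       = refl
  scaleₚ-distrib-+ₚ c (a ∷ p) []      = refl
  scaleₚ-distrib-+ₚ c (a ∷ p) (b ∷ q) =
    cong₂ _∷_ (ℤ.*-distribˡ-+ c a b) (scaleₚ-distrib-+ₚ c p q)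

  scaleₚ-distrib-+ : ∀ a b p → scaleₚ (a + b) p ≡ scaleₚ a p +ₚ scaleₚ b p
  scaleₚ-distrib-+ a b []      = refl
  scaleₚ-distrib-+ a b (c ∷ p) = cong₂ _∷_ (ℤ.*-distribʳ-+ c a b) (scaleₚ-distrib-+ a b p)

  scaleₚ-scaleₚ : ∀ a b p → scaleₚ a (scaleₚ b p) ≡ scaleₚ (a * b) p
  scaleₚ-scaleₚ a b []      = refl
  scaleₚ-scaleₚ a b (c ∷ p) = cong₂ _∷_ (sym (ℤ.*-assoc a b c)) (scaleₚ-scaleₚ a b p)

  scaleₚ-0 : ∀ p → scaleₚ 0ℤ p ≈ₚ 0ₚ
  scaleₚ-0 []      = ≈ₚ-refl
  scaleₚ-0 (a ∷ p) = ∷-≈0ₚ refl (scaleₚ-0 p)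

  scaleₚ-1 : ∀ p → scaleₚ 1ℤ p ≡ p
  scaleₚ-1 []      = refl
  scaleₚ-1 (a ∷ p) = cong₂ _∷_ (ℤ.*-identityˡ a) (scaleₚ-1 p)

  *ₚ-congˡ : ∀ p {q q′} → q ≈ₚ q′ → p *ₚ q ≈ₚ p *ₚ q′
  *ₚ-congˡ []      q≈q′ = ≈ₚ-refl
  *ₚ-congˡ (a ∷ p) q≈q′ = +ₚ-cong (scaleₚ-cong a q≈q′) (∷-cong refl (*ₚ-congˡ p q≈q′))

  *ₚ-zeroʳ : ∀ p → p *ₚ 0ₚ ≈ₚ 0ₚ
  *ₚ-zeroʳ []      = ≈ₚ-refl
  *ₚ-zeroʳ (a ∷ p) = ∷-≈0ₚ refl (*ₚ-zeroʳ p)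

  0∷-*ₚ : ∀ p q → (0ℤ ∷ p) *ₚ q ≈ₚ 0ℤ ∷ (p *ₚ q)
  0∷-*ₚ p q = +ₚ-cong (scaleₚ-0 q) ≈ₚ-refl

  *ₚ-∷ʳ : ∀ p b q → p *ₚ (b ∷ q) ≈ₚ scaleₚ b p +ₚ (0ℤ ∷ (p *ₚ q))
  *ₚ-∷ʳ []      b q = ≈ₚ-sym (∷-≈0ₚ refl ≈ₚ-refl)
  *ₚ-∷ʳ (a ∷ p) b q = ∷-cong (cong (_+ 0ℤ) (ℤ.*-comm a b)) (begin
    scaleₚ a q +ₚ p *ₚ (b ∷ q)                          ≈⟨ +ₚ-cong ≈ₚ-refl (*ₚ-∷ʳ p b q) ⟩
    scaleₚ a q +ₚ (scaleₚ b p +ₚ (0ℤ ∷ (p *ₚ q)))       ≡⟨ +ₚ-assoc (scaleₚ a q) _ _ ⟨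
    (scaleₚ a q +ₚ scaleₚ b p) +ₚ (0ℤ ∷ (p *ₚ q))       ≡⟨ cong (_+ₚ _) (+ₚ-comm (scaleₚ a q) _) ⟩
    (scaleₚ b p +ₚ scaleₚ a q) +ₚ (0ℤ ∷ (p *ₚ q))       ≡⟨ +ₚ-assoc (scaleₚ b p) _ _ ⟩
    scaleₚ b p +ₚ (scaleₚ a q +ₚ (0ℤ ∷ (p *ₚ q)))       ∎)
    where open ≈ₚ-Reasoning

  *ₚ-comm : ∀ p q → p *ₚ q ≈ₚ q *ₚ p
  *ₚ-comm []      q = ≈ₚ-sym (*ₚ-zeroʳ q)
  *ₚ-comm (a ∷ p) q = ≈ₚ-trans (+ₚ-cong ≈ₚ-refl (∷-cong refl (*ₚ-comm p q))) (≈ₚ-sym (*ₚ-∷ʳ q a p))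

  *ₚ-congʳ : ∀ q {p p′} → p ≈ₚ p′ → p *ₚ q ≈ₚ p′ *ₚ q
  *ₚ-congʳ q {p} {p′} p≈p′ =
    ≈ₚ-trans (*ₚ-comm p q) (≈ₚ-trans (*ₚ-congˡ q p≈p′) (*ₚ-comm q p′))

  +ₚ-interchange : ∀ p q r s → (p +ₚ q) +ₚ (r +ₚ s) ≡ (p +ₚ r) +ₚ (q +ₚ s)
  +ₚ-interchange p q r s = begin
    (p +ₚ q) +ₚ (r +ₚ s)  ≡⟨ +ₚ-assoc p q (r +ₚ s) ⟩
    p +ₚ (q +ₚ (r +ₚ s))  ≡⟨ cong (p +ₚ_) (+ₚ-assoc q r s) ⟨
    p +ₚ ((q +ₚ r) +ₚ s)  ≡⟨ cong (λ x → p +ₚ (x +ₚ s)) (+ₚ-comm q r) ⟩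
    p +ₚ ((r +ₚ q) +ₚ s)  ≡⟨ cong (p +ₚ_) (+ₚ-assoc r q s) ⟩
    p +ₚ (r +ₚ (q +ₚ s))  ≡⟨ +ₚ-assoc p r (q +ₚ s) ⟨
    (p +ₚ r) +ₚ (q +ₚ s)  ∎
    where open ≡-Reasoning

  *ₚ-distribʳ-+ₚ : ∀ q p p′ → (p +ₚ p′) *ₚ q ≈ₚ p *ₚ q +ₚ p′ *ₚ q
  *ₚ-distribʳ-+ₚ q []      p′       = ≈ₚ-refl
  *ₚ-distribʳ-+ₚ q (a ∷ p) []       = ≡⇒≈ₚ (sym (+ₚ-identityʳ _))
  *ₚ-distribʳ-+ₚ q (a ∷ p) (b ∷ p′) = begin
    scaleₚ (a + b) q +ₚ (0ℤ ∷ (p +ₚ p′) *ₚ q)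
      ≈⟨ +ₚ-cong ≈ₚ-refl (∷-cong refl (*ₚ-distribʳ-+ₚ q p p′)) ⟩
    scaleₚ (a + b) q +ₚ ((0ℤ ∷ p *ₚ q) +ₚ (0ℤ ∷ p′ *ₚ q))
      ≡⟨ cong (_+ₚ ((0ℤ ∷ p *ₚ q) +ₚ (0ℤ ∷ p′ *ₚ q))) (scaleₚ-distrib-+ a b q) ⟩
    (scaleₚ a q +ₚ scaleₚ b q) +ₚ ((0ℤ ∷ p *ₚ q) +ₚ (0ℤ ∷ p′ *ₚ q))
      ≡⟨ +ₚ-interchange (scaleₚ a q) _ _ _ ⟩
    (scaleₚ a q +ₚ (0ℤ ∷ p *ₚ q)) +ₚ (scaleₚ b q +ₚ (0ℤ ∷ p′ *ₚ q)) ∎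
    where open ≈ₚ-Reasoning

  *ₚ-distribˡ-+ₚ : ∀ p q q′ → p *ₚ (q +ₚ q′) ≈ₚ p *ₚ q +ₚ p *ₚ q′
  *ₚ-distribˡ-+ₚ p q q′ = ≈ₚ-trans (*ₚ-comm p (q +ₚ q′))
    (≈ₚ-trans (*ₚ-distribʳ-+ₚ p q q′) (+ₚ-cong (*ₚ-comm q p) (*ₚ-comm q′ p)))

  scaleₚ-*ₚ : ∀ c p q → scaleₚ c p *ₚ q ≈ₚ scaleₚ c (p *ₚ q)
  scaleₚ-*ₚ c []      q = ≈ₚ-refl
  scaleₚ-*ₚ c (a ∷ p) q = begin
    scaleₚ (c * a) q +ₚ (0ℤ ∷ scaleₚ c p *ₚ q)        ≈⟨ +ₚ-cong ≈ₚ-refl (∷-cong refl (scaleₚ-*ₚ c p q)) ⟩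
    scaleₚ (c * a) q +ₚ (0ℤ ∷ scaleₚ c (p *ₚ q))      ≈⟨ +ₚ-cong ≈ₚ-refl (∷-cong (sym (ℤ.*-zeroʳ c)) ≈ₚ-refl) ⟩
    scaleₚ (c * a) q +ₚ scaleₚ c (0ℤ ∷ p *ₚ q)        ≡⟨ cong (_+ₚ _) (scaleₚ-scaleₚ c a q) ⟨
    scaleₚ c (scaleₚ a q) +ₚ scaleₚ c (0ℤ ∷ p *ₚ q)   ≡⟨ scaleₚ-distrib-+ₚ c (scaleₚ a q) _ ⟨
    scaleₚ c (scaleₚ a q +ₚ (0ℤ ∷ p *ₚ q))            ∎
    where open ≈ₚ-Reasoning

  *ₚ-assoc : ∀ p q r → (p *ₚ q) *ₚ r ≈ₚ p *ₚ (q *ₚ r)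
  *ₚ-assoc []      q r = ≈ₚ-refl
  *ₚ-assoc (a ∷ p) q r = begin
    (scaleₚ a q +ₚ (0ℤ ∷ p *ₚ q)) *ₚ r          ≈⟨ *ₚ-distribʳ-+ₚ r (scaleₚ a q) _ ⟩
    scaleₚ a q *ₚ r +ₚ (0ℤ ∷ p *ₚ q) *ₚ r        ≈⟨ +ₚ-cong (scaleₚ-*ₚ a q r) (0∷-*ₚ (p *ₚ q) r) ⟩
    scaleₚ a (q *ₚ r) +ₚ (0ℤ ∷ (p *ₚ q) *ₚ r)    ≈⟨ +ₚ-cong ≈ₚ-refl (∷-cong refl (*ₚ-assoc p q r)) ⟩
    scaleₚ a (q *ₚ r) +ₚ (0ℤ ∷ p *ₚ (q *ₚ r))    ∎
    where open ≈ₚ-Reasoning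

  *ₚ-identityˡ : ∀ p → 1ₚ *ₚ p ≈ₚ p
  *ₚ-identityˡ p =
    ≈ₚ-trans (+ₚ-cong (≡⇒≈ₚ (scaleₚ-1 p)) (∷-≈0ₚ refl ≈ₚ-refl)) (≡⇒≈ₚ (+ₚ-identityʳ p))

  ℤ[X] : CommutativeRing 0ℓ 0ℓ
  ℤ[X] = record
    { Carrier = Poly ; _≈_ = _≈ₚ_ ; _+_ = _+ₚ_ ; _*_ = _*ₚ_ ; -_ = -ₚ_ ; 0# = 0ₚ ; 1# = 1ₚ
    ; isCommutativeRing = record
      { isRing = record
        { +-isAbelianGroup = record
          { isGroup = record
            { isMonoid = record
              { isSemigroup = record
                { isMagma = record { isEquivalence = ≈ₚ-isEquivalence ; ∙-cong = +ₚ-cong }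
                ; assoc = λ p q r → ≡⇒≈ₚ (+ₚ-assoc p q r) }
              ; identity = (λ p → ≈ₚ-refl) , (λ p → ≡⇒≈ₚ (+ₚ-identityʳ p)) }
            ; inverse = -ₚ‿inverseˡ , -ₚ‿inverseʳ
            ; ⁻¹-cong = scaleₚ-cong (- 1ℤ) }
          ; comm = λ p q → ≡⇒≈ₚ (+ₚ-comm p q) }
        ; *-cong = λ {p} {p′} {q} p≈p′ q≈q′ → ≈ₚ-trans (*ₚ-congʳ q p≈p′) (*ₚ-congˡ p′ q≈q′)
        ; *-assoc = *ₚ-assoc
        ; *-identity = *ₚ-identityˡ , λ p → ≈ₚ-trans (*ₚ-comm p 1ₚ) (*ₚ-identityˡ p)
        ; distrib = *ₚ-distribˡ-+ₚ , *ₚ-distribʳ-+ₚ }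
      ; *-comm = *ₚ-comm } }

  Xₚ-*ₚ : ∀ p → Xₚ *ₚ p ≈ₚ 0ℤ ∷ p
  Xₚ-*ₚ p = +ₚ-cong (scaleₚ-0 p) (∷-cong refl (*ₚ-identityˡ p))

  constant-*ₚ : ∀ c p → (c ∷ []) *ₚ p ≈ₚ scaleₚ c p
  constant-*ₚ c p = ≈ₚ-trans (+ₚ-cong ≈ₚ-refl (∷-≈0ₚ refl ≈ₚ-refl)) (≡⇒≈ₚ (+ₚ-identityʳ _))

  X^ : ℕ → Poly
  X^ zero    = 1ₚ
  X^ (suc k) = Xₚ *ₚ X^ k

module TopCoefficients where
  open Polynomial
  open import Data.Nat as ℕ using (zero; suc; _∸_; z≤n; s≤s)
  open import Data.Integer as ℤ using (0ℤ; 1ℤ)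
  import Data.Integer.Properties as ℤ
  open import Data.List using ([]; _∷_)
  open import Relation.Binary.PropositionalEquality

  -- topCoeff n p k is the coefficient of x^(n − k), and 0 when k > n: for p = det(xI − M) it is a_k.
  topCoeff : ℕ → Poly → ℕ → ℤ
  topCoeff n       p zero    = coeff p n
  topCoeff zero    p (suc k) = 0ℤ
  topCoeff (suc n) p (suc k) = topCoeff n p k

  topCoeff-≤ : ∀ {n k} p → k ≤ n → topCoeff n p k ≡ coeff p (n ∸ k)
  topCoeff-≤ p z≤n       = refl
  topCoeff-≤ p (s≤s k≤n) = topCoeff-≤ p k≤n

  topCoeff-> : ∀ {n k} p → n ℕ.< k → topCoeff n p k ≡ 0ℤ
  topCoeff-> {zero}  {suc k} p _         = refl
  topCoeff-> {suc n} {suc k} p (s≤s n<k) = topCoeff-> p n<k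

  topCoeff-pointwise : ∀ (f : ℤ → ℤ → ℤ) → f 0ℤ 0ℤ ≡ 0ℤ →
    ∀ {p q r} → (∀ j → coeff r j ≡ f (coeff p j) (coeff q j)) →
    ∀ n k → topCoeff n r k ≡ f (topCoeff n p k) (topCoeff n q k)
  topCoeff-pointwise f f00 r≡ n       zero    = r≡ n
  topCoeff-pointwise f f00 r≡ zero    (suc k) = sym f00
  topCoeff-pointwise f f00 r≡ (suc n) (suc k) = topCoeff-pointwise f f00 r≡ n k

  topCoeff-resp : ∀ {p q} → p ≈ₚ q → ∀ n k → topCoeff n p k ≡ topCoeff n q k
  topCoeff-resp {p} {q} p≈q = topCoeff-pointwise (λ x _ → x) refl {q} {q} {p} (coeff-≡ p≈q)

  topCoeff-+ₚ : ∀ p q n k → topCoeff n (p +ₚ q) k ≡ topCoeff n p k ℤ.+ topCoeff n q k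
  topCoeff-+ₚ p q = topCoeff-pointwise ℤ._+_ refl (coeff-+ₚ p q)

  topCoeff-scaleₚ : ∀ c p n k → topCoeff n (scaleₚ c p) k ≡ c ℤ.* topCoeff n p k
  topCoeff-scaleₚ c p = topCoeff-pointwise (λ x _ → c ℤ.* x) (ℤ.*-zeroʳ c) {p} {p} (coeff-scaleₚ c p)

  topCoeff-0∷ : ∀ p n k → topCoeff (suc n) (0ℤ ∷ p) k ≡ topCoeff n p k
  topCoeff-0∷ p n       zero          = refl
  topCoeff-0∷ p zero    (suc zero)    = refl
  topCoeff-0∷ p zero    (suc (suc k)) = refl
  topCoeff-0∷ p (suc n) (suc k)       = topCoeff-0∷ p n k

  topCoeff-negₚ : ∀ p n k → topCoeff n (-ₚ p) k ≡ ℤ.- topCoeff n p k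
  topCoeff-negₚ p = topCoeff-pointwise (λ x _ → ℤ.- x) refl {p} {p} (coeff-negₚ p)

  topCoeff-constant-*ₚ : ∀ c p n k → topCoeff n ((c ∷ []) *ₚ p) k ≡ c ℤ.* topCoeff n p k
  topCoeff-constant-*ₚ c p n k = trans (topCoeff-resp (constant-*ₚ c p) n k) (topCoeff-scaleₚ c p n k)

  topCoeff-Xₚ-*ₚ : ∀ p n k → topCoeff (suc n) (Xₚ *ₚ p) k ≡ topCoeff n p k
  topCoeff-Xₚ-*ₚ p n k = trans (topCoeff-resp (Xₚ-*ₚ p) (suc n) k) (topCoeff-0∷ p n k)

  topCoeff-X^ : ∀ n k → topCoeff n (X^ n) k ≡ topCoeff 0 1ₚ k
  topCoeff-X^ zero    k = refl
  topCoeff-X^ (suc n) k = trans (topCoeff-Xₚ-*ₚ (X^ n) n k) (topCoeff-X^ n k)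

  record Monic (n : ℕ) (p : Poly) : Set where
    field
      leading : coeff p n ≡ 1ℤ
      above   : ∀ j → n < j → coeff p j ≡ 0ℤ

  X^-monic : ∀ n → Monic n (X^ n)
  X^-monic zero    = record { leading = refl ; above = λ { (suc j) _ → refl } }
  X^-monic (suc n) = record
    { leading = trans (coeff-≡ (Xₚ-*ₚ (X^ n)) (suc n)) (Monic.leading (X^-monic n))
    ; above   = λ { (suc j) (s≤s n<j) →
                    trans (coeff-≡ (Xₚ-*ₚ (X^ n)) (suc j)) (Monic.above (X^-monic n) j n<j) } }

module Determinant {c ℓ} (R : CommutativeRing c ℓ) where
  open import Data.Nat using (zero; suc)
  open import Data.Fin using (Fin; zero; suc; punchIn)
  open import Data.Maybe using (nothing)
  open import Tactic.RingSolver using (solve-∀)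
  open import Tactic.RingSolver.Core.AlmostCommutativeRing using (AlmostCommutativeRing; fromCommutativeRing)

  private
    R′ : AlmostCommutativeRing c ℓ
    R′ = fromCommutativeRing R (λ _ → nothing)

    module Identities where
      open AlmostCommutativeRing R′
      swap-signed : ∀ p q r t x → (- p) * (q * (r * (t * x))) ≈ (- r) * (t * (p * (q * x)))
      swap-signed = solve-∀ R′
    open Identities

  open CommutativeRing R hiding (zero)
  open import Algebra.Properties.Semiring.Sum semiring as Sum using (sum)
  open import Algebra.Properties.Ring ring using (-‿distribˡ-*; -‿involutive; -1*x≈-x)
  open import Algebra.Properties.CommutativeSemigroup *-commutativeSemigroup using (x∙yz≈y∙xz)
  open import Algebra.Properties.Group +-group using (inverseʳ-unique)
  open import Relation.Binary.Reasoning.Setoid setoid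

  -- Opaque, so that unification does not unfold ∑ f into a fold and lose track of f.
  opaque
    ∑ : ∀ {n} → (Fin n → Carrier) → Carrier
    ∑ = sum

  opaque
    unfolding ∑

    ∑-suc : ∀ {n} (f : Fin (suc n) → Carrier) → ∑ f ≈ f zero + ∑ (λ i → f (suc i))
    ∑-suc f = refl

    ∑-cong : ∀ {n} {f g : Fin n → Carrier} → (∀ i → f i ≈ g i) → ∑ f ≈ ∑ g
    ∑-cong = Sum.sum-cong-≋

    ∑-zero : ∀ {n} (f : Fin n → Carrier) → (∀ i → f i ≈ 0#) → ∑ f ≈ 0#
    ∑-zero {n} f f≈0 = trans (Sum.sum-cong-≋ f≈0) (Sum.sum-replicate-zero n)

    ∑-distrib-+ : ∀ {n} (f g : Fin n → Carrier) → ∑ (λ i → f i + g i) ≈ ∑ f + ∑ g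
    ∑-distrib-+ = Sum.∑-distrib-+

    ∑-comm : ∀ {m n} (f : Fin m → Fin n → Carrier) → ∑ (λ i → ∑ (f i)) ≈ ∑ (λ j → ∑ (λ i → f i j))
    ∑-comm = Sum.∑-comm

    *-distribˡ-∑ : ∀ {n} x (f : Fin n → Carrier) → x * ∑ f ≈ ∑ (λ i → x * f i)
    *-distribˡ-∑ = Sum.*-distribˡ-sum

  Rows : ℕ → ℕ → Set c
  Rows m n = Fin m → Fin n → Carrier

  Mat : ℕ → Set c
  Mat n = Rows n n

  infixr 5 _▹_
  _▹_ : ∀ {m n} → (Fin n → Carrier) → Rows m n → Rows (suc m) n
  (u ▹ B) zero    = u
  (u ▹ B) (suc i) = B i

  sgn : ℕ → Carrier
  sgn zero    = 1#
  sgn (suc k) = - sgn k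

  minor : ∀ {m n} → Fin (suc n) → Rows m (suc n) → Rows m n
  minor j B r c = B r (punchIn j c)

  det : ∀ n → Mat n → Carrier
  det zero    A = 1#
  det (suc n) A = ∑ λ j → sgn (finToℕ j) * (A zero j * det n (minor j (λ r → A (suc r))))

  ∑-head : ∀ {n} (f : Fin (suc n) → Carrier) → (∀ i → f (suc i) ≈ 0#) → ∑ f ≈ f zero
  ∑-head f tail≈0 = trans (∑-suc f) (trans (+-congˡ (∑-zero _ tail≈0)) (+-identityʳ _))

  det-cong : ∀ n {A B : Mat n} → (∀ i j → A i j ≈ B i j) → det n A ≈ det n B
  det-cong zero    A≈B = refl
  det-cong (suc n) {A} {B} A≈B = ∑-cong λ j →
    *-congˡ (*-cong (A≈B zero j) (det-cong n {minor j (λ r → A (suc r))} {minor j (λ r → B (suc r))}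
                                    λ r c → A≈B (suc r) (punchIn j c)))

  det-+-row₀ : ∀ {n} u w (B : Rows n (suc n)) →
    det (suc n) ((λ j → u j + w j) ▹ B) ≈ det (suc n) (u ▹ B) + det (suc n) (w ▹ B)
  det-+-row₀ u w B =
    trans (∑-cong λ j → trans (*-congˡ (distribʳ _ (u j) (w j))) (distribˡ _ _ _))
          (∑-distrib-+ _ _)

  det-*-row₀ : ∀ {n} a u (B : Rows n (suc n)) →
    det (suc n) ((λ j → a * u j) ▹ B) ≈ a * det (suc n) (u ▹ B)
  det-*-row₀ a u B = trans (∑-cong λ j → trans (*-congˡ (*-assoc a (u j) _)) (x∙yz≈y∙xz _ a _))
                           (sym (*-distribˡ-∑ a _))

  det-+-row₁ : ∀ {n} u w₁ w₂ (B : Rows n (suc (suc n))) →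
    det (suc (suc n)) (u ▹ (λ j → w₁ j + w₂ j) ▹ B)
      ≈ det (suc (suc n)) (u ▹ w₁ ▹ B) + det (suc (suc n)) (u ▹ w₂ ▹ B)
  det-+-row₁ u w₁ w₂ B = trans
    (∑-cong λ j → trans (*-congˡ (*-congˡ (det-+-row₀ (w₁ ∘′ punchIn j) (w₂ ∘′ punchIn j) (minor j B))))
                            (trans (*-congˡ (distribˡ _ _ _)) (distribˡ _ _ _)))
    (∑-distrib-+ _ _)
    where open import Function using (_∘′_)

  column₀-cofactor : ∀ {n} → Mat (suc n) → Fin (suc n) → Carrier
  column₀-cofactor {n} A i = sgn (finToℕ i) * (A i zero * det n (λ r c → A (punchIn i r) (suc c)))

  det-expand-column₀ : ∀ n (A : Mat (suc n)) → det (suc n) A ≈ ∑ (column₀-cofactor A)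
  det-expand-column₀ zero    A = ∑-cong λ { zero → refl }
  det-expand-column₀ (suc n) A = trans (∑-suc _) (trans (+-congˡ (begin
    ∑ (λ j → sgn (suc (finToℕ j)) * (a j * det (suc n) (minor (suc j) (λ r → A (suc r)))))
      ≈⟨ ∑-cong (λ j → *-congˡ (*-congˡ (det-expand-column₀ n (minor (suc j) (λ r → A (suc r)))))) ⟩
    ∑ (λ j → sgn (suc (finToℕ j)) * (a j * ∑ (λ i → sgn (finToℕ i) * (b i * X i j))))
      ≈⟨ ∑-cong (λ j → trans (*-congˡ (*-distribˡ-∑ (a j) _)) (*-distribˡ-∑ (sgn (suc (finToℕ j))) _)) ⟩
    ∑ (λ j → ∑ (λ i → sgn (suc (finToℕ j)) * (a j * (sgn (finToℕ i) * (b i * X i j)))))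
      ≈⟨ ∑-comm _ ⟩
    ∑ (λ i → ∑ (λ j → sgn (suc (finToℕ j)) * (a j * (sgn (finToℕ i) * (b i * X i j)))))
      ≈⟨ ∑-cong (λ i → ∑-cong λ j → swap-signed (sgn (finToℕ j)) (a j) (sgn (finToℕ i)) (b i) (X i j)) ⟩
    ∑ (λ i → ∑ (λ j → sgn (suc (finToℕ i)) * (b i * (sgn (finToℕ j) * (a j * X i j)))))
      ≈⟨ ∑-cong (λ i → trans (*-congˡ (*-distribˡ-∑ (b i) _)) (*-distribˡ-∑ (sgn (suc (finToℕ i))) _)) ⟨
    ∑ (λ i → sgn (suc (finToℕ i)) * (b i * ∑ (λ j → sgn (finToℕ j) * (a j * X i j)))) ∎))
      (sym (∑-suc _)))
    where
    a b : Fin (suc n) → Carrier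
    a j = A zero (suc j)
    b i = A (suc i) zero
    X : Fin (suc n) → Fin (suc n) → Carrier
    X i j = det n (λ r c → A (suc (punchIn i r)) (suc (punchIn j c)))

  det-equal-rows₀₁ : ∀ n (A : Mat (suc (suc n))) → (∀ j → A zero j ≈ A (suc zero) j) →
    det (suc (suc n)) A ≈ 0#
  cofactor-below-row₁≈0 : ∀ n (A : Mat (suc (suc n))) → (∀ j → A zero j ≈ A (suc zero) j) →
    ∀ i → column₀-cofactor A (suc (suc i)) ≈ 0#

  det-equal-rows₀₁ n A row₀≈row₁ = begin
    det (suc (suc n)) A
      ≈⟨ det-expand-column₀ (suc n) A ⟩
    ∑ cof
      ≈⟨ trans (∑-suc cof) (+-congˡ (∑-suc _)) ⟩
    cof zero + (cof (suc zero) + ∑ (λ i → cof (suc (suc i))))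
      ≈⟨ +-congˡ (+-congˡ (∑-zero _ (cofactor-below-row₁≈0 n A row₀≈row₁))) ⟩
    cof zero + (cof (suc zero) + 0#)
      ≈⟨ +-congˡ (+-identityʳ _) ⟩
    cof zero + cof (suc zero)
      ≈⟨ +-congʳ (*-congˡ (*-cong (row₀≈row₁ zero) (det-cong (suc n) C₀≈C₁))) ⟩
    1# * (A (suc zero) zero * det (suc n) (C (suc zero))) + cof (suc zero)
      ≈⟨ trans (+-congˡ (sym (-‿distribˡ-* _ _))) (-‿inverseʳ _) ⟩
    0# ∎
    where
    cof = column₀-cofactor A
    C : Fin (suc (suc n)) → Mat (suc n)
    C i r c = A (punchIn i r) (suc c)
    C₀≈C₁ : ∀ r c → C zero r c ≈ C (suc zero) r c
    C₀≈C₁ zero    c = sym (row₀≈row₁ (suc c))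
    C₀≈C₁ (suc r) c = refl

  cofactor-below-row₁≈0 (suc n) A row₀≈row₁ i =
    trans (*-congˡ (trans (*-congˡ (det-equal-rows₀₁ n (λ r c → A (punchIn (suc (suc i)) r) (suc c))
                                                      λ j → row₀≈row₁ (suc j))) (zeroʳ _))) (zeroʳ _)

  det-swap-rows₀₁ : ∀ {n} u w (B : Rows n (suc (suc n))) →
    det (suc (suc n)) (w ▹ u ▹ B) ≈ - det (suc (suc n)) (u ▹ w ▹ B)
  det-swap-rows₀₁ {n} u w B = inverseʳ-unique (D u w) (D w u) (begin
    D u w + D w u                  ≈⟨ +-cong (+-identityˡ _) (+-identityʳ _) ⟨
    (0# + D u w) + (D w u + 0#)    ≈⟨ +-cong (+-congʳ (det-equal-rows₀₁ n (u ▹ u ▹ B) λ _ → refl))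
                                             (+-congˡ (det-equal-rows₀₁ n (w ▹ w ▹ B) λ _ → refl)) ⟨
    (D u u + D u w) + (D w u + D w w) ≈⟨ +-cong (det-+-row₁ u u w B) (det-+-row₁ w u w B) ⟨
    D u u+w + D w u+w              ≈⟨ det-+-row₀ u w (u+w ▹ B) ⟨
    D u+w u+w                      ≈⟨ det-equal-rows₀₁ n (u+w ▹ u+w ▹ B) (λ _ → refl) ⟩
    0#                             ∎)
    where
    D : (Fin (suc (suc n)) → Carrier) → (Fin (suc (suc n)) → Carrier) → Carrier
    D x y = det (suc (suc n)) (x ▹ y ▹ B)
    u+w : Fin (suc (suc n)) → Carrier
    u+w j = u j + w j

  det-cong-minors : ∀ {n} u (M N : Rows n (suc n)) →
    (∀ j → det n (minor j M) ≈ det n (minor j N)) → det (suc n) (u ▹ M) ≈ det (suc n) (u ▹ N)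
  det-cong-minors u M N minors≈ = ∑-cong λ j → *-congˡ (*-congˡ (minors≈ j))

  det-add-multiples-of-row₀ : ∀ n u (B : Rows n (suc n)) (c : Fin n → Carrier) →
    det (suc n) (u ▹ (λ k j → B k j + c k * u j)) ≈ det (suc n) (u ▹ B)
  det-add-multiples-of-row₀ zero    u B c = refl
  det-add-multiples-of-row₀ (suc n) u B c = begin
    det (suc (suc n)) (u ▹ B′)                               ≡⟨⟩
    det (suc (suc n)) (u ▹ B′ zero ▹ B′₊)                    ≈⟨ det-swap-rows₀₁ (B′ zero) u B′₊ ⟩
    - det (suc (suc n)) (B′ zero ▹ u ▹ B′₊)
        ≈⟨ -‿cong (det-+-row₀ (B zero) (λ j → c zero * u j) (u ▹ B′₊)) ⟩
    - (det (suc (suc n)) (B zero ▹ u ▹ B′₊) + det (suc (suc n)) ((λ j → c zero * u j) ▹ u ▹ B′₊))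
        ≈⟨ -‿cong (+-congˡ (det-*-row₀ (c zero) u (u ▹ B′₊))) ⟩
    - (det (suc (suc n)) (B zero ▹ u ▹ B′₊) + c zero * det (suc (suc n)) (u ▹ u ▹ B′₊))
        ≈⟨ -‿cong (+-congˡ (trans (*-congˡ (det-equal-rows₀₁ n (u ▹ u ▹ B′₊) λ _ → refl)) (zeroʳ _))) ⟩
    - (det (suc (suc n)) (B zero ▹ u ▹ B′₊) + 0#)            ≈⟨ -‿cong (+-identityʳ _) ⟩
    - det (suc (suc n)) (B zero ▹ u ▹ B′₊)
        ≈⟨ -‿cong (det-cong-minors (B zero) (u ▹ B′₊) (u ▹ B₊) minors≈) ⟩
    - det (suc (suc n)) (B zero ▹ u ▹ B₊)                    ≈⟨ -‿cong (det-swap-rows₀₁ u (B zero) B₊) ⟩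
    - - det (suc (suc n)) (u ▹ B zero ▹ B₊)                  ≈⟨ -‿involutive _ ⟩
    det (suc (suc n)) (u ▹ B zero ▹ B₊)                      ≡⟨⟩
    det (suc (suc n)) (u ▹ B)                                ∎
    where
    B′ : Rows (suc n) (suc (suc n))
    B′ k j = B k j + c k * u j
    B′₊ B₊ : Rows n (suc (suc n))
    B′₊ k = B′ (suc k)
    B₊ k = B (suc k)
    minors≈ : ∀ j → det (suc n) (minor j (u ▹ B′₊)) ≈ det (suc n) (minor j (u ▹ B₊))
    minors≈ j = det-add-multiples-of-row₀ n (λ c′ → u (punchIn j c′)) (minor j B₊) (λ k → c (suc k))

  det-column₀-zero-below : ∀ n (A : Mat (suc n)) → (∀ i → A (suc i) zero ≈ 0#) →
    det (suc n) A ≈ A zero zero * det n (λ r c → A (suc r) (suc c))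
  det-column₀-zero-below n A below≈0 = begin
    det (suc n) A                                  ≈⟨ det-expand-column₀ n A ⟩
    ∑ (column₀-cofactor A)
      ≈⟨ ∑-head _ (λ i → trans (*-congˡ (trans (*-congʳ (below≈0 i)) (zeroˡ _))) (zeroʳ _)) ⟩
    1# * (A zero zero * det n (λ r c → A (suc r) (suc c))) ≈⟨ *-identityˡ _ ⟩
    A zero zero * det n (λ r c → A (suc r) (suc c)) ∎

  infixr 5 _⊲_
  _⊲_ : ∀ {m n} → (Fin m → Carrier) → Rows m n → Rows m (suc n)
  (v ⊲ A) i zero    = v i
  (v ⊲ A) i (suc c) = A i c

  det-+-column₀ : ∀ n v w (A : Rows (suc n) n) →
    det (suc n) ((λ i → v i + w i) ⊲ A) ≈ det (suc n) (v ⊲ A) + det (suc n) (w ⊲ A)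
  det-+-column₀ n v w A = begin
    det (suc n) ((λ i → v i + w i) ⊲ A)  ≈⟨ det-expand-column₀ n ((λ i → v i + w i) ⊲ A) ⟩
    ∑ (column₀-cofactor ((λ i → v i + w i) ⊲ A))
      ≈⟨ ∑-cong (λ i → trans (*-congˡ (distribʳ _ (v i) (w i))) (distribˡ _ _ _)) ⟩
    ∑ (λ i → column₀-cofactor (v ⊲ A) i + column₀-cofactor (w ⊲ A) i)
      ≈⟨ ∑-distrib-+ _ _ ⟩
    ∑ (column₀-cofactor (v ⊲ A)) + ∑ (column₀-cofactor (w ⊲ A))
      ≈⟨ +-cong (det-expand-column₀ n (v ⊲ A)) (det-expand-column₀ n (w ⊲ A)) ⟨
    det (suc n) (v ⊲ A) + det (suc n) (w ⊲ A) ∎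

  det-row₀-only-entry₀ : ∀ {n} u (B : Rows n (suc n)) → (∀ j → u (suc j) ≈ 0#) →
    det (suc n) (u ▹ B) ≈ u zero * det n (minor zero B)
  det-row₀-only-entry₀ u B u≈0 =
    trans (∑-head _ λ j → trans (*-congˡ (trans (*-congʳ (u≈0 j)) (zeroˡ _))) (zeroʳ _)) (*-identityˡ _)

  det-row₀-only-entry₁ : ∀ {n} u (B : Rows (suc n) (suc (suc n))) → u zero ≈ 0# → (∀ j → u (suc (suc j)) ≈ 0#) →
    det (suc (suc n)) (u ▹ B) ≈ - (u (suc zero) * det (suc n) (minor (suc zero) B))
  det-row₀-only-entry₁ {n} u B u₀≈0 u≈0 = begin
    det (suc (suc n)) (u ▹ B)
      ≈⟨ ∑-suc _ ⟩
    1# * (u zero * det (suc n) (minor zero B)) + ∑ (λ j → sgn (finToℕ (suc j)) * (u (suc j) * det (suc n) (minor (suc j) B)))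
      ≈⟨ +-cong (trans (*-congˡ (trans (*-congʳ u₀≈0) (zeroˡ _))) (zeroʳ _))
                (∑-head _ λ j → trans (*-congˡ (trans (*-congʳ (u≈0 j)) (zeroˡ _))) (zeroʳ _)) ⟩
    0# + (- 1#) * (u (suc zero) * det (suc n) (minor (suc zero) B))
      ≈⟨ trans (+-identityˡ _) (-1*x≈-x _) ⟩
    - (u (suc zero) * det (suc n) (minor (suc zero) B)) ∎

module CharacteristicPolynomial where
  open Polynomial
  open TopCoefficients
  open import Data.Nat as ℕ using (zero; suc)
  import Data.Nat.Properties as ℕ
  open import Data.Integer as ℤ using (-_; 1ℤ)
  import Data.Integer.Properties as ℤ
  open import Data.List using ([]; _∷_)
  open import Data.Fin using (Fin; zero; suc; _≟_)
  open import Data.Bool using (if_then_else_)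
  open import Relation.Nullary using (yes; no)
  open import Relation.Nullary.Decidable using (⌊_⌋)
  open import Relation.Binary.PropositionalEquality

  open Determinant ℤ[X] public

  charMatrix : ∀ n → Matrix ℤ n → Matrix Poly n
  charMatrix n M i j = if ⌊ i ≟ j ⌋ then (- M i j) ∷ 1ℤ ∷ [] else (- M i j) ∷ []

  sgn≈sign : ∀ k → sgn k ≈ₚ sign k ∷ []
  sgn≈sign zero    = ≈ₚ-refl
  sgn≈sign (suc k) = ≈ₚ-trans (scaleₚ-cong (- 1ℤ) (sgn≈sign k)) (∷-cong (ℤ.-1*i≡-i (sign k)) ≈ₚ-refl)

  sumFin≈∑ : ∀ {n} (f g : Fin n → Poly) → (∀ j → f j ≈ₚ g j) → sumFin f ≈ₚ ∑ g
  sumFin≈∑ {zero}  f g f≈g = ≈ₚ-sym (∑-zero g λ ())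
  sumFin≈∑ {suc n} f g f≈g =
    ≈ₚ-trans (+ₚ-cong (f≈g zero) (sumFin≈∑ _ _ λ j → f≈g (suc j))) (≈ₚ-sym (∑-suc g))

  detₚ≈det : ∀ n A → detₚ n A ≈ₚ det n A
  detₚ≈det zero    A = ≈ₚ-refl
  detₚ≈det (suc n) A = sumFin≈∑ _ _ λ j → ≈ₚ-sym (≈ₚ-trans
    (CommutativeRing.*-cong ℤ[X] (sgn≈sign (finToℕ j)) (*ₚ-congˡ (A zero j) (≈ₚ-sym (detₚ≈det n _))))
    (constant-*ₚ _ _))

  charPoly≈det : ∀ n M → charPoly n M ≈ₚ det n (charMatrix n M)
  charPoly≈det n M = detₚ≈det n (charMatrix n M)

  charCoeff≡topCoeff : ∀ n M k → charCoeff n M k ≡ topCoeff n (charPoly n M) k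
  charCoeff≡topCoeff n M k with k ℕ.≤? n
  ... | yes k≤n = sym (topCoeff-≤ (charPoly n M) k≤n)
  ... | no  k≰n = sym (topCoeff-> (charPoly n M) (ℕ.≰⇒> k≰n))

module Divisibility where
  open Polynomial
  open TopCoefficients
  open CharacteristicPolynomial
  open import Data.Nat as ℕ using (zero; suc; _∸_; z≤n; s≤s)
  import Data.Nat.Properties as ℕ
  open import Data.Integer as ℤ using (+_; -_; 0ℤ; 1ℤ; -1ℤ)
  import Data.Integer.Properties as ℤ
  open import Data.Integer.Divisibility.Signed
    using (_∣_; divides; ∣-trans; ∣m∣n⇒∣m+n; *-monoʳ-∣; *-monoˡ-∣; ∣ᵤ⇒∣; ∣⇒∣ᵤ)
  import Data.Integer.Divisibility as Unsigned
  open import Data.List using ([]; _∷_)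
  open import Data.Fin using (Fin; zero; suc; punchIn; _≟_)
  open import Data.Bool using (true; false)
  open import Data.Sum using (inj₁; inj₂)
  open import Relation.Nullary using (yes; no)
  open import Relation.Nullary.Decidable using (⌊_⌋)
  open import Relation.Binary.PropositionalEquality
  open import Data.Integer.Tactic.RingSolver using (solve-∀)

  pow2-+ : ∀ a b → pow2 (a ℕ.+ b) ≡ pow2 a ℤ.* pow2 b
  pow2-+ a b = trans (cong +_ (ℕ.^-distribˡ-+-* 2 a b)) (ℤ.pos-* (2 ℕ.^ a) (2 ℕ.^ b))

  pow2-∣ : ∀ {a b} → a ≤ b → pow2 a ∣ pow2 b
  pow2-∣ {a} {b} a≤b = divides (pow2 (b ∸ a)) (trans (cong pow2 (sym (ℕ.m∸n+n≡m a≤b))) (pow2-+ (b ∸ a) a))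

  *-pres-∣ : ∀ {a b x y} → a ∣ x → b ∣ y → a ℤ.* b ∣ x ℤ.* y
  *-pres-∣ {a} {b} {x} a∣x b∣y = ∣-trans (*-monoˡ-∣ b a∣x) (*-monoʳ-∣ x b∣y)

  ∣0 : ∀ {a} → a ∣ 0ℤ
  ∣0 = divides 0ℤ refl

  1∣ : ∀ {x} → pow2 0 ∣ x
  1∣ {x} = divides x (sym (ℤ.*-identityʳ x))

  -- Weight≥ d p says that 2^d divides p(2y) in ℤ[y].
  record Weight≥ (d : ℕ) (p : Poly) : Set where
    constructor weight≥
    field divides-coeff : ∀ j → pow2 (d ∸ j) ∣ coeff p j
  open Weight≥

  weight-resp : ∀ {d p q} → p ≈ₚ q → Weight≥ d p → Weight≥ d q
  weight-resp {d} p≈q w = weight≥ λ j → subst (pow2 (d ∸ j) ∣_) (coeff-≡ p≈q j) (divides-coeff w j)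

  weight-0ₚ : ∀ {d} → Weight≥ d 0ₚ
  weight-0ₚ = weight≥ λ j → ∣0

  weight-0 : ∀ p → Weight≥ 0 p
  weight-0 p = weight≥ λ j → subst (λ e → pow2 e ∣ coeff p j) (sym (ℕ.0∸n≡0 j)) 1∣

  weight-+ₚ : ∀ {d p q} → Weight≥ d p → Weight≥ d q → Weight≥ d (p +ₚ q)
  weight-+ₚ {d} {p} {q} wp wq = weight≥ λ j →
    subst (pow2 (d ∸ j) ∣_) (sym (coeff-+ₚ p q j)) (∣m∣n⇒∣m+n (divides-coeff wp j) (divides-coeff wq j))

  +-∸-≤ : ∀ a b j → (a ℕ.+ b) ∸ j ≤ a ℕ.+ (b ∸ j)
  +-∸-≤ a b       zero    = ℕ.≤-refl
  +-∸-≤ a zero    (suc j) = ℕ.m∸n≤m (a ℕ.+ 0) (suc j)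
  +-∸-≤ a (suc b) (suc j) rewrite ℕ.+-suc a b = +-∸-≤ a b j

  weight-*ₚ : ∀ {a b} p q → Weight≥ a p → Weight≥ b q → Weight≥ (a ℕ.+ b) (p *ₚ q)
  weight-*ₚ         []      q wp wq = weight-0ₚ
  weight-*ₚ {a} {b} (x ∷ p) q wp wq = weight-+ₚ head-term shifted-tail
    where
    head-term : Weight≥ (a ℕ.+ b) (scaleₚ x q)
    head-term = weight≥ λ j → subst (pow2 ((a ℕ.+ b) ∸ j) ∣_) (sym (coeff-scaleₚ x q j))
      (∣-trans (pow2-∣ (+-∸-≤ a b j))
               (subst (_∣ x ℤ.* coeff q j) (sym (pow2-+ a (b ∸ j))) (*-pres-∣ (divides-coeff wp zero) (divides-coeff wq j))))
    tail-weight : Weight≥ (a ∸ 1) p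
    tail-weight = weight≥ λ j → subst (λ e → pow2 e ∣ coeff p j) (sym (ℕ.∸-+-assoc a 1 j)) (divides-coeff wp (suc j))
    shift-≤ : ∀ a j → (a ℕ.+ b) ∸ suc j ≤ ((a ∸ 1) ℕ.+ b) ∸ j
    shift-≤ zero    j = ℕ.∸-monoʳ-≤ b (ℕ.n≤1+n j)
    shift-≤ (suc a) j = ℕ.≤-refl
    shifted-tail : Weight≥ (a ℕ.+ b) (0ℤ ∷ p *ₚ q)
    shifted-tail = weight≥ λ
      { zero    → ∣0
      ; (suc j) → ∣-trans (pow2-∣ (shift-≤ a j)) (divides-coeff (weight-*ₚ p q tail-weight wq) j) }

  weight-∑ : ∀ {n d} (f : Fin n → Poly) → (∀ j → Weight≥ d (f j)) → Weight≥ d (∑ f)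
  weight-∑ {zero}  f wf = weight-resp (≈ₚ-sym (∑-zero f λ ())) weight-0ₚ
  weight-∑ {suc n} f wf =
    weight-resp (≈ₚ-sym (∑-suc f)) (weight-+ₚ (wf zero) (weight-∑ (λ j → f (suc j)) (λ j → wf (suc j))))

  weight-det : ∀ n A → (∀ i j → Weight≥ 1 (A i j)) → Weight≥ n (det n A)
  weight-det-▹ : ∀ n d u B → (∀ j → Weight≥ d (u j)) → (∀ i j → Weight≥ 1 (B i j)) →
    Weight≥ (d ℕ.+ n) (det (suc n) (u ▹ B))
  weight-det zero    A wA = weight-0 _
  weight-det (suc n) A wA = weight-det-▹ n 1 (A zero) (λ r → A (suc r)) (wA zero) (λ i → wA (suc i))
  weight-det-▹ n d u B wu wB = weight-∑ _ λ j → weight-*ₚ (sgn (finToℕ j)) _ (weight-0 _)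
    (weight-*ₚ (u j) _ (wu j) (weight-det n (minor j B) λ r c → wB r (punchIn j c)))

  charMatrix-coeff₀ : ∀ n M i j → coeff (charMatrix n M i j) 0 ≡ - M i j
  charMatrix-coeff₀ n M i j with ⌊ i ≟ j ⌋
  ... | true  = refl
  ... | false = refl

  RowsCongruentMod2 : ∀ {n} → Matrix ℤ n → Set
  RowsCongruentMod2 M = ∀ i i′ j → M i j ≡ M i′ j [mod + 2 ]

  charPoly-weight : ∀ m M → RowsCongruentMod2 M → Weight≥ m (charPoly (suc m) M)
  charPoly-weight m M rows≡ =
    weight-resp (≈ₚ-trans (det-add-multiples-of-row₀ m u B (λ _ → -ₚ 1ₚ)) (≈ₚ-sym (charPoly≈det (suc m) M)))
                (weight-det-▹ m 0 u B′ (λ j → weight-0 _) B′-weight)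
    where
    u = charMatrix (suc m) M zero
    B B′ : Rows m (suc m)
    B k = charMatrix (suc m) M (suc k)
    B′ k j = B k j +ₚ (-ₚ 1ₚ) *ₚ u j
    B′-coeff₀ : ∀ k j → coeff (B′ k j) 0 ≡ M zero j ℤ.- M (suc k) j
    B′-coeff₀ k j = begin
      coeff (B′ k j) 0
        ≡⟨ coeff-+ₚ (B k j) _ 0 ⟩
      coeff (B k j) 0 ℤ.+ coeff ((-ₚ 1ₚ) *ₚ u j) 0
        ≡⟨ cong (ℤ._+_ (coeff (B k j) 0)) (trans (coeff-≡ (constant-*ₚ _ (u j)) 0) (coeff-scaleₚ _ (u j) 0)) ⟩
      coeff (B k j) 0 ℤ.+ (- 1ℤ ℤ.* 1ℤ) ℤ.* coeff (u j) 0
        ≡⟨ cong₂ (λ x y → x ℤ.+ (- 1ℤ ℤ.* 1ℤ) ℤ.* y)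
                 (charMatrix-coeff₀ (suc m) M (suc k) j) (charMatrix-coeff₀ (suc m) M zero j) ⟩
      - M (suc k) j ℤ.+ (- 1ℤ ℤ.* 1ℤ) ℤ.* (- M zero j)
        ≡⟨ rearrange (M zero j) (M (suc k) j) ⟩
      M zero j ℤ.- M (suc k) j ∎
      where
      open ≡-Reasoning
      rearrange : ∀ a b → - b ℤ.+ (- 1ℤ ℤ.* 1ℤ) ℤ.* (- a) ≡ a ℤ.- b
      rearrange = solve-∀
    B′-weight : ∀ k j → Weight≥ 1 (B′ k j)
    B′-weight k j = weight≥ λ
      { zero    → subst (+ 2 ∣_) (sym (B′-coeff₀ k j)) (∣ᵤ⇒∣ (rows≡ zero (suc k) j))
      ; (suc t) → subst (λ e → pow2 e ∣ coeff (B′ k j) (suc t)) (sym (ℕ.0∸n≡0 t)) 1∣ }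

  weight⇒topCoeff-divisible : ∀ m p → Weight≥ m p → ∀ i → pow2 i ∣ topCoeff m p i
  weight⇒topCoeff-divisible m p wp i with i ℕ.≤? m
  ... | yes i≤m = subst (pow2 i ∣_) (sym (topCoeff-≤ p i≤m))
                    (subst (λ e → pow2 e ∣ coeff p (m ∸ i)) (ℕ.m∸[m∸n]≡n i≤m) (divides-coeff wp (m ∸ i)))
  ... | no  i≰m = subst (pow2 i ∣_) (sym (topCoeff-> p (ℕ.≰⇒> i≰m))) ∣0

  charPoly-topCoeff-divisible : ∀ n M → RowsCongruentMod2 M → ∀ i → pow2 i ∣ topCoeff n (charPoly n M) (suc i)
  charPoly-topCoeff-divisible zero    M rows≡ i = ∣0
  charPoly-topCoeff-divisible (suc m) M rows≡ i = weight⇒topCoeff-divisible m _ (charPoly-weight m M rows≡) i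

  charCoeff-divisible : ∀ n M → RowsCongruentMod2 M → ∀ i → 1 ≤ i → pow2 (i ∸ 1) Unsigned.∣ charCoeff n M i
  charCoeff-divisible n M rows≡ (suc i) _ =
    ∣⇒∣ᵤ (subst (pow2 i ∣_) (sym (charCoeff≡topCoeff n M (suc i))) (charPoly-topCoeff-divisible n M rows≡ i))

  U⇒rows-congruent : ∀ {n M} → U n M → RowsCongruentMod2 M
  U⇒rows-congruent (±1 , _) i i′ j with ±1 i j | ±1 i′ j
  ... | inj₁ ≡1  | inj₁ ≡1′  rewrite ≡1  | ≡1′  = ∣⇒∣ᵤ {+ 2} (divides 0ℤ refl)
  ... | inj₁ ≡1  | inj₂ ≡-1′ rewrite ≡1  | ≡-1′ = ∣⇒∣ᵤ {+ 2} (divides 1ℤ refl)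
  ... | inj₂ ≡-1 | inj₁ ≡1′  rewrite ≡-1 | ≡1′  = ∣⇒∣ᵤ {+ 2} (divides -1ℤ refl)
  ... | inj₂ ≡-1 | inj₂ ≡-1′ rewrite ≡-1 | ≡-1′ = ∣⇒∣ᵤ {+ 2} (divides 0ℤ refl)

  InCU⇒InRHS : ∀ e n t → InCU e n t → InRHS e t
  InCU⇒InRHS e n t (M , M∈U , residues) =
    charCoeff n M , (λ i 2≤i _ → charCoeff-divisible n M (U⇒rows-congruent M∈U) i (ℕ.≤-trans (s≤s z≤n) 2≤i)) , residues

module FlipMatrices where
  open Polynomial
  open CharacteristicPolynomial
  open import Data.Nat as ℕ using (zero; suc)
  open import Data.Integer as ℤ using (+_; 0ℤ; 1ℤ; -1ℤ)
  open import Data.List using ([]; _∷_)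
  open import Data.Fin using (Fin; zero; suc; _≟_)
  open import Data.Bool using (Bool; true; false; if_then_else_)
  open import Data.Sum using (_⊎_; inj₁; inj₂)
  open import Relation.Nullary using (yes; no)
  open import Relation.Nullary.Decidable using (⌊_⌋)
  open import Relation.Binary.PropositionalEquality as ≡ using (_≡_)
  open CommutativeRing ℤ[X]
    using (ring; +-abelianGroup; _≈_; _+_; _*_; -_; 1#; refl; sym; trans; +-cong; +-congˡ; +-congʳ;
           *-congˡ; -‿cong; *-identityˡ; *-identityʳ; setoid)
  open import Relation.Binary.Reasoning.Setoid setoid
  open import Algebra.Properties.Ring ring using (-1*x≈-x)
  open import Algebra.Properties.AbelianGroup +-abelianGroup using (xyx⁻¹≈y)

  Bits : Set
  Bits = ℕ → Bool

  infixr 5 _◂_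
  _◂_ : Bool → Bits → Bits
  (b ◂ β) zero    = b
  (b ◂ β) (suc k) = β k

  tail : Bits → Bits
  tail β k = β (suc k)

  -- The all-ones matrix with the entry (a, a+1) negated whenever β a holds.
  flipEntry : Bits → ℕ → ℕ → ℤ
  flipEntry β zero    (suc zero) = if β 0 then -1ℤ else 1ℤ
  flipEntry β (suc a) (suc b)    = flipEntry (tail β) a b
  flipEntry β _       _          = 1ℤ

  flipMatrix : ∀ n → Bits → Matrix ℤ n
  flipMatrix n β i j = flipEntry β (finToℕ i) (finToℕ j)

  -- Indexed by ℕ rather than Fin so that charFlip (suc n) β without its first row and column is
  -- definitionally charFlip n (tail β).
  charEntry : Bits → ℕ → ℕ → Poly
  charEntry β a b = if a ℕ.≡ᵇ b then ℤ.- flipEntry β a b ∷ 1ℤ ∷ [] else ℤ.- flipEntry β a b ∷ []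

  charFlip : ∀ n → Bits → Mat n
  charFlip n β i j = charEntry β (finToℕ i) (finToℕ j)

  χ : ℕ → Bits → Poly
  χ n β = det n (charFlip n β)

  ≟⇒≡ᵇ : ∀ {n} (i j : Fin n) → ⌊ i ≟ j ⌋ ≡ (finToℕ i ℕ.≡ᵇ finToℕ j)
  ≟⇒≡ᵇ zero    zero    = ≡.refl
  ≟⇒≡ᵇ zero    (suc j) = ≡.refl
  ≟⇒≡ᵇ (suc i) zero    = ≡.refl
  ≟⇒≡ᵇ (suc i) (suc j) with i ≟ j | ≟⇒≡ᵇ i j
  ... | yes _ | i≟j = i≟j
  ... | no  _ | i≟j = i≟j

  charPoly-flip≈χ : ∀ n β → charPoly n (flipMatrix n β) ≈ χ n β
  charPoly-flip≈χ n β = trans (charPoly≈det n (flipMatrix n β)) (det-cong n λ i j → ≡⇒≈ₚ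
    (≡.cong (λ b → if b then ℤ.- flipMatrix n β i j ∷ 1ℤ ∷ [] else ℤ.- flipMatrix n β i j ∷ []) (≟⇒≡ᵇ i j)))

  twoIf : Bool → ℤ
  twoIf b = if b then + 2 else 0ℤ

  -- Adding the all-ones matrix to xI − M makes it upper triangular with x on the diagonal.
  det-charFlip+ones : ∀ n β → det n (λ r c → charFlip n β r c + 1ₚ) ≈ X^ n
  det-charFlip+ones zero    β = refl
  det-charFlip+ones (suc n) β =
    trans (det-column₀-zero-below n (λ r c → charFlip (suc n) β r c + 1ₚ) (λ i → ∷-≈0ₚ ≡.refl ≈ₚ-refl))
          (*-congˡ {x = Xₚ} (det-charFlip+ones n (tail β)))

  X-at₀ : ∀ {m} → Fin (suc m) → Poly
  X-at₀ zero    = Xₚ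
  X-at₀ (suc _) = 0ₚ

  twoIf-at₁ : ∀ {m} → Bool → Fin (suc (suc m)) → Poly
  twoIf-at₁ b (suc zero) = twoIf b ∷ []
  twoIf-at₁ b _          = 0ₚ

  -- The first row of xI − M is (x, 0, …) + (0, 2·[β 0], 0, …) − (1, …, 1); expanding along it gives
  -- χ-step, where minor₀₁ is eliminated using the expansion of χ′ along its first column.
  module _ (n : ℕ) (β : Bits) where
    private
      R : Rows (suc n) (suc (suc n))
      R r = charFlip (suc (suc n)) β (suc r)
      χ′ χ″ minor₀₁ : Poly
      χ′ = χ (suc n) (tail β)
      χ″ = χ n (tail (tail β))
      minor₀₁ = det (suc n) (minor (suc zero) R)

    row₀-split : ∀ j → charFlip (suc (suc n)) β zero j ≈ X-at₀ j + (twoIf-at₁ (β 0) j + - 1#)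
    row₀-split zero          = refl
    row₀-split (suc zero)    with β 0
    ... | true  = refl
    ... | false = refl
    row₀-split (suc (suc j)) = refl

    det-X-at₀-row : det (suc (suc n)) (X-at₀ ▹ R) ≈ Xₚ * χ′
    det-X-at₀-row = det-row₀-only-entry₀ X-at₀ R (λ _ → refl)

    det-twoIf-at₁-row : det (suc (suc n)) (twoIf-at₁ (β 0) ▹ R) ≈ - ((twoIf (β 0) ∷ []) * minor₀₁)
    det-twoIf-at₁-row = det-row₀-only-entry₁ (twoIf-at₁ (β 0)) R refl (λ _ → refl)

    det-ones-row : det (suc (suc n)) ((λ _ → 1#) ▹ R) ≈ X^ (suc n)
    det-ones-row = begin
      det (suc (suc n)) ((λ _ → 1#) ▹ R)
        ≈⟨ det-add-multiples-of-row₀ (suc n) (λ _ → 1#) R (λ _ → 1#) ⟨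
      det (suc (suc n)) R′
        ≈⟨ det-column₀-zero-below (suc n) R′ (λ { zero → ∷-≈0ₚ ≡.refl ≈ₚ-refl
                                                 ; (suc i) → ∷-≈0ₚ ≡.refl ≈ₚ-refl }) ⟩
      1# * det (suc n) (λ r c → R′ (suc r) (suc c))
        ≈⟨ *-identityˡ _ ⟩
      det (suc n) (λ r c → R′ (suc r) (suc c))
        ≈⟨ det-cong (suc n) {B = λ r c → charFlip (suc n) (tail β) r c + 1#}
                    (λ r c → +-congˡ {x = charFlip (suc n) (tail β) r c} (*-identityʳ 1#)) ⟩
      det (suc n) (λ r c → charFlip (suc n) (tail β) r c + 1#)
        ≈⟨ det-charFlip+ones (suc n) (tail β) ⟩
      X^ (suc n) ∎
      where
      R′ : Mat (suc (suc n))
      R′ = (λ _ → 1#) ▹ (λ k j → R k j + 1# * 1#)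

    χ′≈Xχ″+minor₀₁ : χ′ ≈ Xₚ * χ″ + minor₀₁
    χ′≈Xχ″+minor₀₁ = begin
      χ′
        ≈⟨ det-cong (suc n) {A = charFlip (suc n) (tail β)} {B = (λ i → X-at₀ i + col₀ i) ⊲ rest} split-column₀ ⟩
      det (suc n) ((λ i → X-at₀ i + col₀ i) ⊲ rest)
        ≈⟨ det-+-column₀ n X-at₀ col₀ rest ⟩
      det (suc n) (X-at₀ ⊲ rest) + det (suc n) (col₀ ⊲ rest)
        ≈⟨ +-cong (det-column₀-zero-below n (X-at₀ ⊲ rest) (λ _ → refl))
                  (det-cong (suc n) {A = col₀ ⊲ rest} {B = minor (suc zero) R}
                            λ r → λ { zero → refl ; (suc c) → refl }) ⟩
      Xₚ * χ″ + minor₀₁ ∎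
      where
      col₀ : Fin (suc n) → Poly
      col₀ i = R i zero
      rest : Rows (suc n) n
      rest i c = charFlip (suc n) (tail β) i (suc c)
      split-column₀ : ∀ i c → charFlip (suc n) (tail β) i c ≈ ((λ i → X-at₀ i + col₀ i) ⊲ rest) i c
      split-column₀ zero    zero    = refl
      split-column₀ (suc i) zero    = refl
      split-column₀ i       (suc c) = refl

    χ-step : χ (suc (suc n)) β ≈ Xₚ * χ′ + (- ((twoIf (β 0) ∷ []) * (χ′ + - (Xₚ * χ″))) + - X^ (suc n))
    χ-step = begin
      χ (suc (suc n)) β
        ≈⟨ det-cong (suc (suc n)) {A = charFlip (suc (suc n)) β} {B = row₀ ▹ R}
                    (λ { zero j → row₀-split j ; (suc r) j → refl }) ⟩
      D row₀
        ≈⟨ trans (det-+-row₀ X-at₀ _ R) (+-congˡ (det-+-row₀ (twoIf-at₁ (β 0)) (λ _ → - 1#) R)) ⟩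
      D X-at₀ + (D (twoIf-at₁ (β 0)) + D (λ _ → - 1#))
        ≈⟨ +-cong det-X-at₀-row (+-cong det-twoIf-at₁-row det-minus-ones-row) ⟩
      Xₚ * χ′ + (- ((twoIf (β 0) ∷ []) * minor₀₁) + - X^ (suc n))
        ≈⟨ +-congˡ {x = Xₚ * χ′} (+-congʳ {x = - X^ (suc n)}
             (-‿cong (*-congˡ {x = twoIf (β 0) ∷ []} minor₀₁≈χ′-Xχ″))) ⟩
      Xₚ * χ′ + (- ((twoIf (β 0) ∷ []) * (χ′ + - (Xₚ * χ″))) + - X^ (suc n)) ∎
      where
      row₀ : Fin (suc (suc n)) → Poly
      row₀ j = X-at₀ j + (twoIf-at₁ (β 0) j + - 1#)
      D : (Fin (suc (suc n)) → Poly) → Poly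
      D u = det (suc (suc n)) (u ▹ R)
      det-minus-ones-row : D (λ _ → - 1#) ≈ - X^ (suc n)
      det-minus-ones-row = begin
        D (λ _ → - 1#)                    ≈⟨ det-*-row₀ (- 1#) (λ _ → 1#) R ⟩
        - 1# * D (λ _ → 1#)               ≈⟨ *-congˡ {x = - 1#} det-ones-row ⟩
        - 1# * X^ (suc n)                 ≈⟨ -1*x≈-x _ ⟩
        - X^ (suc n)                      ∎
      minor₀₁≈χ′-Xχ″ : minor₀₁ ≈ χ′ + - (Xₚ * χ″)
      minor₀₁≈χ′-Xχ″ = sym (trans (+-congʳ χ′≈Xχ″+minor₀₁) (xyx⁻¹≈y (Xₚ * χ″) minor₀₁))

  flipEntry-±1 : ∀ β a b → flipEntry β a b ≡ 1ℤ ⊎ flipEntry β a b ≡ -1ℤ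
  flipEntry-±1 β zero    zero          = inj₁ ≡.refl
  flipEntry-±1 β zero    (suc zero)    with β 0
  ... | true  = inj₂ ≡.refl
  ... | false = inj₁ ≡.refl
  flipEntry-±1 β zero    (suc (suc b)) = inj₁ ≡.refl
  flipEntry-±1 β (suc a) zero          = inj₁ ≡.refl
  flipEntry-±1 β (suc a) (suc b)       = flipEntry-±1 (tail β) a b

  flipEntry-diagonal : ∀ β a → flipEntry β a a ≡ 1ℤ
  flipEntry-diagonal β zero    = ≡.refl
  flipEntry-diagonal β (suc a) = flipEntry-diagonal (tail β) a

  flipMatrix-U : ∀ n β → U n (flipMatrix n β)
  flipMatrix-U n β = (λ i j → flipEntry-±1 β (finToℕ i) (finToℕ j)) , (λ i → flipEntry-diagonal β (finToℕ i))

module FlipCoefficients where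
  open Polynomial
  open TopCoefficients
  open CharacteristicPolynomial
  open Divisibility
  open FlipMatrices
  open import Data.Nat as ℕ using (zero; suc; s≤s)
  import Data.Nat.Properties as ℕ
  open import Data.Integer as ℤ using (0ℤ; 1ℤ; -1ℤ)
  import Data.Integer.Properties as ℤ
  open import Data.Integer.Divisibility.Signed using (_∣_)
  open import Data.List using ([]; _∷_)
  open import Data.Fin using (zero; suc)
  open import Relation.Binary.PropositionalEquality
  open import Data.Integer.Tactic.RingSolver using (solve-∀)

  χ-topCoeff-step : ∀ L n β k → topCoeff (suc (suc L)) (χ (suc (suc n)) β) (suc k) ≡
    topCoeff (suc L) (χ (suc n) (tail β)) (suc k)
      ℤ.+ (ℤ.- (twoIf (β 0) ℤ.* (topCoeff (suc L) (χ (suc n) (tail β)) k ℤ.- topCoeff L (χ n (tail (tail β))) k))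
           ℤ.- topCoeff (suc L) (X^ (suc n)) k)
  χ-topCoeff-step L n β k = begin
    T (χ (suc (suc n)) β)
      ≡⟨ topCoeff-resp (χ-step n β) (suc (suc L)) (suc k) ⟩
    T (Xₚ *ₚ χ′ +ₚ (-ₚ (c *ₚ (χ′ +ₚ -ₚ (Xₚ *ₚ χ″))) +ₚ -ₚ X^ (suc n)))
      ≡⟨ topCoeff-+ₚ _ _ (suc (suc L)) (suc k) ⟩
    T (Xₚ *ₚ χ′) ℤ.+ T (-ₚ (c *ₚ (χ′ +ₚ -ₚ (Xₚ *ₚ χ″))) +ₚ -ₚ X^ (suc n))
      ≡⟨ cong₂ ℤ._+_ (topCoeff-Xₚ-*ₚ χ′ (suc L) (suc k)) (topCoeff-+ₚ _ _ (suc (suc L)) (suc k)) ⟩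
    topCoeff (suc L) χ′ (suc k) ℤ.+ (T (-ₚ (c *ₚ (χ′ +ₚ -ₚ (Xₚ *ₚ χ″)))) ℤ.+ T (-ₚ X^ (suc n)))
      ≡⟨ cong (ℤ._+_ (topCoeff (suc L) χ′ (suc k)))
           (cong₂ ℤ._+_ (trans (topCoeff-negₚ _ (suc (suc L)) (suc k)) (cong ℤ.-_ correction))
                        (topCoeff-negₚ _ (suc (suc L)) (suc k))) ⟩
    topCoeff (suc L) χ′ (suc k)
      ℤ.+ (ℤ.- (twoIf (β 0) ℤ.* (topCoeff (suc L) χ′ k ℤ.- topCoeff L χ″ k)) ℤ.- topCoeff (suc L) (X^ (suc n)) k) ∎
    where
    open ≡-Reasoning
    T : Poly → ℤ
    T p = topCoeff (suc (suc L)) p (suc k)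
    χ′ χ″ c : Poly
    χ′ = χ (suc n) (tail β)
    χ″ = χ n (tail (tail β))
    c = twoIf (β 0) ∷ []
    correction : T (c *ₚ (χ′ +ₚ -ₚ (Xₚ *ₚ χ″))) ≡ twoIf (β 0) ℤ.* (topCoeff (suc L) χ′ k ℤ.- topCoeff L χ″ k)
    correction = begin
      T (c *ₚ (χ′ +ₚ -ₚ (Xₚ *ₚ χ″)))
        ≡⟨ topCoeff-constant-*ₚ _ _ (suc (suc L)) (suc k) ⟩
      twoIf (β 0) ℤ.* topCoeff (suc L) (χ′ +ₚ -ₚ (Xₚ *ₚ χ″)) k
        ≡⟨ cong (twoIf (β 0) ℤ.*_) (trans (topCoeff-+ₚ _ _ (suc L) k) (cong (ℤ._+_ (topCoeff (suc L) χ′ k))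
             (trans (topCoeff-negₚ _ (suc L) k) (cong ℤ.-_ (topCoeff-Xₚ-*ₚ χ″ L k))))) ⟩
      twoIf (β 0) ℤ.* (topCoeff (suc L) χ′ k ℤ.- topCoeff L χ″ k) ∎

  χ-monic-step : ∀ n β → Monic (suc n) (χ (suc n) (tail β)) → Monic n (χ n (tail (tail β))) →
    Monic (suc (suc n)) (χ (suc (suc n)) β)
  χ-monic-step n β χ′-monic χ″-monic = record
    { leading = trans (shift (suc n) ℕ.≤-refl) (Monic.leading χ′-monic)
    ; above   = λ { (suc j) (s≤s n+1<j) → trans (shift j (ℕ.<⇒≤ n+1<j)) (Monic.above χ′-monic j n+1<j) } }
    where
    shift : ∀ j → suc n ≤ j → coeff (χ (suc (suc n)) β) (suc j) ≡ coeff (χ (suc n) (tail β)) j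
    shift j n<j = begin
      coeff (χ (suc (suc n)) β) (suc j)
        ≡⟨ χ-topCoeff-step j n β 0 ⟩
      x ℤ.+ (ℤ.- (twoIf (β 0) ℤ.* (coeff (χ (suc n) (tail β)) (suc j) ℤ.- coeff (χ n (tail (tail β))) j))
             ℤ.- coeff (X^ (suc n)) (suc j))
        ≡⟨ cong₂ (λ y z → x ℤ.+ (ℤ.- (twoIf (β 0) ℤ.* (y ℤ.- z)) ℤ.- coeff (X^ (suc n)) (suc j)))
                 (Monic.above χ′-monic (suc j) (s≤s n<j)) (Monic.above χ″-monic j n<j) ⟩
      x ℤ.+ (ℤ.- (twoIf (β 0) ℤ.* 0ℤ) ℤ.- coeff (X^ (suc n)) (suc j))
        ≡⟨ cong₂ (λ y z → x ℤ.+ (ℤ.- y ℤ.- z))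
                 (ℤ.*-zeroʳ (twoIf (β 0))) (Monic.above (X^-monic (suc n)) (suc j) (s≤s n<j)) ⟩
      x ℤ.+ 0ℤ
        ≡⟨ ℤ.+-identityʳ x ⟩
      x ∎
      where
      open ≡-Reasoning
      x = coeff (χ (suc n) (tail β)) j

  χ-one : ∀ β → χ 1 β ≈ₚ -1ℤ ∷ 1ℤ ∷ []
  χ-one β = det-row₀-only-entry₀ (charFlip 1 β zero) (λ ()) (λ ())

  χ-monic : ∀ n β → Monic n (χ n β)
  χ-monic zero          β = record { leading = refl ; above = λ { (suc j) _ → refl } }
  χ-monic (suc zero)    β = record
    { leading = coeff-≡ (χ-one β) 1
    ; above   = λ { (suc (suc j)) _ → coeff-≡ (χ-one β) (suc (suc j)) ; (suc zero) (s≤s ()) } }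
  χ-monic (suc (suc n)) β = χ-monic-step n β (χ-monic (suc n) (tail β)) (χ-monic n (tail (tail β)))

  flipCoeff : ℕ → Bits → ℕ → ℤ
  flipCoeff n β = topCoeff n (χ n β)

  flipCoeff-step : ∀ n β k → flipCoeff (suc (suc n)) β (suc k) ≡
    flipCoeff (suc n) (tail β) (suc k)
      ℤ.+ (ℤ.- (twoIf (β 0) ℤ.* (flipCoeff (suc n) (tail β) k ℤ.- flipCoeff n (tail (tail β)) k)) ℤ.- topCoeff 0 1ₚ k)
  flipCoeff-step n β k = trans (χ-topCoeff-step n n β k) (cong (λ x → a ℤ.+ (b ℤ.- x)) (topCoeff-X^ (suc n) k))
    where
    a = flipCoeff (suc n) (tail β) (suc k)
    b = ℤ.- (twoIf (β 0) ℤ.* (flipCoeff (suc n) (tail β) k ℤ.- flipCoeff n (tail (tail β)) k))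

  -- Δ β k = −(−2)^(k−1) if β 0, …, β (k−2) all hold, and 0 otherwise (for k ≥ 1).
  Δ : Bits → ℕ → ℤ
  Δ β zero          = 0ℤ
  Δ β (suc zero)    = -1ℤ
  Δ β (suc (suc k)) = ℤ.- (twoIf (β 0) ℤ.* Δ (tail β) (suc k))

  flipCoeff-prepend : ∀ n β k → k ≤ suc n → flipCoeff (suc n) β k ≡ flipCoeff n (tail β) k ℤ.+ Δ β k
  flipCoeff-prepend n       β zero          _ =
    trans (Monic.leading (χ-monic (suc n) β)) (sym (trans (ℤ.+-identityʳ _) (Monic.leading (χ-monic n (tail β)))))
  flipCoeff-prepend zero    β (suc zero)    _ = coeff-≡ (χ-one β) 0
  flipCoeff-prepend zero    β (suc (suc k)) (s≤s ())
  flipCoeff-prepend (suc n) β (suc zero)    _ = begin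
    flipCoeff (suc (suc n)) β 1
      ≡⟨ flipCoeff-step n β 0 ⟩
    x ℤ.+ (ℤ.- (twoIf (β 0) ℤ.* (flipCoeff (suc n) (tail β) 0 ℤ.- flipCoeff n (tail (tail β)) 0)) ℤ.- 1ℤ)
      ≡⟨ cong₂ (λ y z → x ℤ.+ (ℤ.- (twoIf (β 0) ℤ.* (y ℤ.- z)) ℤ.- 1ℤ))
               (Monic.leading (χ-monic (suc n) (tail β))) (Monic.leading (χ-monic n (tail (tail β)))) ⟩
    x ℤ.+ (ℤ.- (twoIf (β 0) ℤ.* (1ℤ ℤ.- 1ℤ)) ℤ.- 1ℤ)
      ≡⟨ simplify x (twoIf (β 0)) ⟩
    x ℤ.+ -1ℤ ∎
    where
    open ≡-Reasoning
    x = flipCoeff (suc n) (tail β) 1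
    simplify : ∀ x c → x ℤ.+ (ℤ.- (c ℤ.* (1ℤ ℤ.- 1ℤ)) ℤ.- 1ℤ) ≡ x ℤ.+ -1ℤ
    simplify = solve-∀
  flipCoeff-prepend (suc n) β (suc (suc k)) (s≤s k+1≤n+1) = begin
    flipCoeff (suc (suc n)) β (suc (suc k))
      ≡⟨ flipCoeff-step n β (suc k) ⟩
    x ℤ.+ (ℤ.- (twoIf (β 0) ℤ.* (flipCoeff (suc n) (tail β) (suc k) ℤ.- y)) ℤ.- 0ℤ)
      ≡⟨ cong (λ z → x ℤ.+ (ℤ.- (twoIf (β 0) ℤ.* (z ℤ.- y)) ℤ.- 0ℤ))
              (flipCoeff-prepend n (tail β) (suc k) k+1≤n+1) ⟩
    x ℤ.+ (ℤ.- (twoIf (β 0) ℤ.* ((y ℤ.+ Δ (tail β) (suc k)) ℤ.- y)) ℤ.- 0ℤ)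
      ≡⟨ simplify x (twoIf (β 0)) y (Δ (tail β) (suc k)) ⟩
    x ℤ.+ Δ β (suc (suc k)) ∎
    where
    open ≡-Reasoning
    x = flipCoeff (suc n) (tail β) (suc (suc k))
    y = flipCoeff n (tail (tail β)) (suc k)
    simplify : ∀ x c y d → x ℤ.+ (ℤ.- (c ℤ.* ((y ℤ.+ d) ℤ.- y)) ℤ.- 0ℤ) ≡ x ℤ.+ ℤ.- (c ℤ.* d)
    simplify = solve-∀

  charCoeff-flipMatrix : ∀ n β k → charCoeff n (flipMatrix n β) k ≡ flipCoeff n β k
  charCoeff-flipMatrix n β k = trans (charCoeff≡topCoeff n (flipMatrix n β) k) (topCoeff-resp (charPoly-flip≈χ n β) n k)

  flipCoeff-divisible : ∀ m γ k → pow2 k ∣ flipCoeff m γ (suc k)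
  flipCoeff-divisible m γ k = subst (pow2 k ∣_) (topCoeff-resp (charPoly-flip≈χ m γ) m (suc k))
    (charPoly-topCoeff-divisible m (flipMatrix m γ) (U⇒rows-congruent (flipMatrix-U m γ)) k)

module Blocks where
  open FlipMatrices
  open FlipCoefficients
  open import Data.Nat as ℕ using (zero; suc; s≤s)
  import Data.Nat.Properties as ℕ
  open import Data.Integer as ℤ using (+_; 0ℤ; 1ℤ)
  import Data.Integer.Properties as ℤ
  open import Data.Bool using (true; false)
  open import Relation.Binary.PropositionalEquality
  open import Data.Integer.Tactic.RingSolver using (solve-∀)

  ones : ℕ → Bits → Bits
  ones zero    γ = γ
  ones (suc i) γ = true ◂ ones i γ

  Δ-ones-below : ∀ i γ {k} → γ 0 ≡ false → i < k → Δ (ones i γ) (suc k) ≡ 0ℤ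
  Δ-ones-below zero    γ {suc k} γ₀≡false _ rewrite γ₀≡false = refl
  Δ-ones-below (suc i) γ {suc k} γ₀≡false (s≤s i<k) rewrite Δ-ones-below i γ γ₀≡false i<k = refl

  Δ-ones-top : ∀ L γ → Δ (ones L γ) (suc L) ≡ sign (suc L) ℤ.* pow2 L
  Δ-ones-top zero    γ = refl
  Δ-ones-top (suc L) γ = begin
    ℤ.- (+ 2 ℤ.* Δ (ones L γ) (suc L))            ≡⟨ cong (λ x → ℤ.- (+ 2 ℤ.* x)) (Δ-ones-top L γ) ⟩
    ℤ.- (+ 2 ℤ.* (sign (suc L) ℤ.* pow2 L))        ≡⟨ rearrange (sign (suc L)) (pow2 L) ⟩
    ℤ.- sign (suc L) ℤ.* (+ 2 ℤ.* pow2 L)          ≡⟨ cong (ℤ.- sign (suc L) ℤ.*_) (sym (ℤ.pos-* 2 (2 ℕ.^ L))) ⟩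
    sign (suc (suc L)) ℤ.* pow2 (suc L)            ∎
    where
    open ≡-Reasoning
    rearrange : ∀ s p → ℤ.- (+ 2 ℤ.* (s ℤ.* p)) ≡ ℤ.- s ℤ.* (+ 2 ℤ.* p)
    rearrange = solve-∀

  flipCoeff-ones-below : ∀ i m γ k → γ 0 ≡ false → i < k → suc k ≤ m →
    flipCoeff (i ℕ.+ m) (ones i γ) (suc k) ≡ flipCoeff m γ (suc k)
  flipCoeff-ones-below zero    m γ k γ₀≡false i<k k<m = refl
  flipCoeff-ones-below (suc i) m γ k γ₀≡false i<k k<m = begin
    flipCoeff (suc i ℕ.+ m) (ones (suc i) γ) (suc k)
      ≡⟨ flipCoeff-prepend (i ℕ.+ m) (ones (suc i) γ) (suc k) (ℕ.≤-trans k<m (ℕ.m≤n+m m (suc i))) ⟩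
    flipCoeff (i ℕ.+ m) (ones i γ) (suc k) ℤ.+ Δ (ones (suc i) γ) (suc k)
      ≡⟨ cong₂ ℤ._+_ (flipCoeff-ones-below i m γ k γ₀≡false (ℕ.<-trans (ℕ.n<1+n i) i<k) k<m)
                     (Δ-ones-below (suc i) γ γ₀≡false i<k) ⟩
    flipCoeff m γ (suc k) ℤ.+ 0ℤ
      ≡⟨ ℤ.+-identityʳ _ ⟩
    flipCoeff m γ (suc k) ∎
    where open ≡-Reasoning

  flipCoeff-prepend-false : ∀ n γ k → suc (suc k) ≤ suc n →
    flipCoeff (suc n) (false ◂ γ) (suc (suc k)) ≡ flipCoeff n γ (suc (suc k))
  flipCoeff-prepend-false n γ k k<n = trans (flipCoeff-prepend n (false ◂ γ) (suc (suc k)) k<n) (ℤ.+-identityʳ _)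

  block : ℕ → Bits → Bits
  block L γ = false ◂ ones (suc L) γ

  flipCoeff-block-above : ∀ L m γ k → γ 0 ≡ false → suc (suc L) < k → k ≤ m →
    flipCoeff (suc (suc L) ℕ.+ m) (block L γ) k ≡ flipCoeff m γ k
  flipCoeff-block-above L m γ (suc (suc k)) γ₀≡false (s≤s L+1<k+1) k≤m =
    trans (flipCoeff-prepend-false (suc L ℕ.+ m) (ones (suc L) γ) k (ℕ.≤-trans k≤m (ℕ.m≤n+m m (suc (suc L)))))
          (flipCoeff-ones-below (suc L) m γ (suc k) γ₀≡false L+1<k+1 k≤m)

  flipCoeff-block-top : ∀ L m γ → γ 0 ≡ false → suc (suc L) ≤ m →
    flipCoeff (suc (suc L) ℕ.+ m) (block L γ) (suc (suc L)) ≡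
      flipCoeff m γ (suc (suc L)) ℤ.+ sign (suc (suc L)) ℤ.* pow2 (suc L)
  flipCoeff-block-top L m γ γ₀≡false L+2≤m = begin
    flipCoeff (suc (suc L) ℕ.+ m) (block L γ) (suc (suc L))
      ≡⟨ flipCoeff-prepend-false (suc L ℕ.+ m) (ones (suc L) γ) L (ℕ.≤-trans L+2≤m (ℕ.m≤n+m m (suc (suc L)))) ⟩
    flipCoeff (suc L ℕ.+ m) (ones (suc L) γ) (suc (suc L))
      ≡⟨ flipCoeff-prepend (L ℕ.+ m) (ones (suc L) γ) (suc (suc L))
                           (s≤s (ℕ.≤-trans (ℕ.n≤1+n (suc L)) (ℕ.≤-trans L+2≤m (ℕ.m≤n+m m L)))) ⟩
    flipCoeff (L ℕ.+ m) (ones L γ) (suc (suc L)) ℤ.+ Δ (ones (suc L) γ) (suc (suc L))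
      ≡⟨ cong₂ ℤ._+_ (flipCoeff-ones-below L m γ (suc L) γ₀≡false (ℕ.n<1+n L) L+2≤m) (Δ-ones-top (suc L) γ) ⟩
    flipCoeff m γ (suc (suc L)) ℤ.+ sign (suc (suc L)) ℤ.* pow2 (suc L) ∎
    where open ≡-Reasoning

  blocks : ℕ → ℕ → Bits → Bits
  blocks L zero    γ = γ
  blocks L (suc q) γ = block L (blocks L q γ)

  blocksSize : ℕ → ℕ → ℕ → ℕ
  blocksSize L zero    m = m
  blocksSize L (suc q) m = suc (suc L) ℕ.+ blocksSize L q m

  blocks-head : ∀ L q γ → γ 0 ≡ false → blocks L q γ 0 ≡ false
  blocks-head L zero    γ γ₀≡false = γ₀≡false
  blocks-head L (suc q) γ γ₀≡false = refl

  blocksSize-≥ : ∀ L q m → m ≤ blocksSize L q m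
  blocksSize-≥ L zero    m = ℕ.≤-refl
  blocksSize-≥ L (suc q) m = ℕ.≤-trans (blocksSize-≥ L q m) (ℕ.m≤n+m _ (suc (suc L)))

  blocksSize-≤ : ∀ {L e} q m → suc (suc L) ≤ e → blocksSize L q m ≤ q ℕ.* e ℕ.+ m
  blocksSize-≤ zero    m L+2≤e = ℕ.≤-refl
  blocksSize-≤ {L} {e} (suc q) m L+2≤e = ℕ.≤-trans (ℕ.+-mono-≤ L+2≤e (blocksSize-≤ q m L+2≤e))
                                                   (ℕ.≤-reflexive (sym (ℕ.+-assoc e (q ℕ.* e) m)))

  flipCoeff-blocks-above : ∀ L q m γ k → γ 0 ≡ false → suc (suc L) < k → k ≤ m →
    flipCoeff (blocksSize L q m) (blocks L q γ) k ≡ flipCoeff m γ k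
  flipCoeff-blocks-above L zero    m γ k γ₀≡false L+2<k k≤m = refl
  flipCoeff-blocks-above L (suc q) m γ k γ₀≡false L+2<k k≤m =
    trans (flipCoeff-block-above L (blocksSize L q m) (blocks L q γ) k (blocks-head L q γ γ₀≡false) L+2<k
                                 (ℕ.≤-trans k≤m (blocksSize-≥ L q m)))
          (flipCoeff-blocks-above L q m γ k γ₀≡false L+2<k k≤m)

  flipCoeff-blocks-top : ∀ L q m γ → γ 0 ≡ false → suc (suc L) ≤ m →
    flipCoeff (blocksSize L q m) (blocks L q γ) (suc (suc L)) ≡
      flipCoeff m γ (suc (suc L)) ℤ.+ + q ℤ.* (sign (suc (suc L)) ℤ.* pow2 (suc L))
  flipCoeff-blocks-top L zero    m γ γ₀≡false L+2≤m = sym (ℤ.+-identityʳ _)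
  flipCoeff-blocks-top L (suc q) m γ γ₀≡false L+2≤m = begin
    flipCoeff (blocksSize L (suc q) m) (blocks L (suc q) γ) (suc (suc L))
      ≡⟨ flipCoeff-block-top L (blocksSize L q m) (blocks L q γ) (blocks-head L q γ γ₀≡false)
                             (ℕ.≤-trans L+2≤m (blocksSize-≥ L q m)) ⟩
    flipCoeff (blocksSize L q m) (blocks L q γ) (suc (suc L)) ℤ.+ δ
      ≡⟨ cong (ℤ._+ δ) (flipCoeff-blocks-top L q m γ γ₀≡false L+2≤m) ⟩
    (flipCoeff m γ (suc (suc L)) ℤ.+ + q ℤ.* δ) ℤ.+ δ
      ≡⟨ one-more (flipCoeff m γ (suc (suc L))) (+ q) δ ⟩
    flipCoeff m γ (suc (suc L)) ℤ.+ (1ℤ ℤ.+ + q) ℤ.* δ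
      ≡⟨ cong (λ x → flipCoeff m γ (suc (suc L)) ℤ.+ x ℤ.* δ) (sym (ℤ.pos-+ 1 q)) ⟩
    flipCoeff m γ (suc (suc L)) ℤ.+ + suc q ℤ.* δ ∎
    where
    open ≡-Reasoning
    δ = sign (suc (suc L)) ℤ.* pow2 (suc L)
    one-more : ∀ a q d → (a ℤ.+ q ℤ.* d) ℤ.+ d ≡ a ℤ.+ (1ℤ ℤ.+ q) ℤ.* d
    one-more = solve-∀

  zeros : ℕ → Bits → Bits
  zeros zero    γ = γ
  zeros (suc p) γ = false ◂ zeros p γ

  flipCoeff-zeros : ∀ p m γ k → 2 ≤ k → k ≤ m → flipCoeff (p ℕ.+ m) (zeros p γ) k ≡ flipCoeff m γ k
  flipCoeff-zeros zero    m γ k             2≤k k≤m = refl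
  flipCoeff-zeros (suc p) m γ (suc (suc k)) 2≤k k≤m =
    trans (flipCoeff-prepend-false (p ℕ.+ m) (zeros p γ) k (ℕ.≤-trans k≤m (ℕ.m≤n+m m (suc p))))
          (flipCoeff-zeros p m γ (suc (suc k)) 2≤k k≤m)
  flipCoeff-zeros (suc p) m γ (suc zero)    (s≤s ()) k≤m

module Realisation where
  open FlipMatrices
  open FlipCoefficients
  open Blocks
  open import Data.Nat as ℕ using (zero; suc; _∸_; z≤n; s≤s)
  import Data.Nat.Properties as ℕ
  open import Data.Integer as ℤ using (+_; 1ℤ)
  import Data.Integer.Properties as ℤ
  open import Data.Integer.Divisibility.Signed using (_∣_; divides; quotient; ∣m∣n⇒∣m+n; ∣ᵤ⇒∣; ∣⇒∣ᵤ)
  open import Data.Integer.DivMod using (_%ℕ_; _/ℕ_; a≡a%ℕn+[a/ℕn]*n; n%ℕd<d)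
  open import Data.Bool using (false)
  open import Data.Sum using (inj₁; inj₂)
  open import Relation.Binary.PropositionalEquality
  open import Data.Integer.Tactic.RingSolver using (solve-∀)

  sign-squared : ∀ k → sign k ℤ.* sign k ≡ 1ℤ
  sign-squared zero    = refl
  sign-squared (suc k) = trans (negate² (sign k)) (sign-squared k)
    where
    negate² : ∀ s → ℤ.- s ℤ.* ℤ.- s ≡ s ℤ.* s
    negate² = solve-∀

  blockBudget : ℕ → ℕ
  blockBudget e = 2 ℕ.^ e ℕ.* e

  sizeBound : ℕ → ℕ → ℕ
  sizeBound e zero    = e
  sizeBound e (suc d) = blockBudget e ℕ.+ sizeBound e d

  module Construction (e : ℕ) (a : ℕ → ℤ) (a-divisible : ∀ i → 2 ≤ i → i ≤ e → pow2 (i ∸ 1) ∣ a i) where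

    record Approximation (K bound : ℕ) : Set where
      field
        size       : ℕ
        bits       : Bits
        bits-head  : bits 0 ≡ false
        e≤size     : e ≤ size
        size≤bound : size ≤ bound
        agrees     : ∀ k → K ≤ k → 2 ≤ k → k ≤ e → pow2 e ∣ flipCoeff size bits k ℤ.- a k

    start : Approximation (suc e) e
    start = record
      { size = e ; bits = λ _ → false ; bits-head = refl ; e≤size = ℕ.≤-refl ; size≤bound = ℕ.≤-refl
      ; agrees = λ k e<k _ k≤e → ⊥-elim (ℕ.<⇒≱ e<k k≤e) }
      where open import Data.Empty using (⊥-elim)

    widen : ∀ {K K′ bound} → (∀ k → K ≤ k → 2 ≤ k → K′ ≤ k) →
      Approximation K′ bound → Approximation K (blockBudget e ℕ.+ bound)
    widen K′≤ approx = record
      { size = size ; bits = bits ; bits-head = bits-head ; e≤size = e≤size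
      ; size≤bound = ℕ.≤-trans size≤bound (ℕ.m≤n+m _ (blockBudget e))
      ; agrees     = λ k K≤k 2≤k k≤e → agrees k (K′≤ k K≤k 2≤k) 2≤k k≤e }
      where open Approximation approx

    fix-coordinate : ∀ L {bound} → suc (suc L) ≤ e →
      Approximation (suc (suc (suc L))) bound → Approximation (suc (suc L)) (blockBudget e ℕ.+ bound)
    fix-coordinate L K≤e approx = record
      { size       = blocksSize L q m
      ; bits       = blocks L q γ
      ; bits-head  = blocks-head L q γ γ₀
      ; e≤size     = ℕ.≤-trans e≤m (blocksSize-≥ L q m)
      ; size≤bound = ℕ.≤-trans (blocksSize-≤ q m K≤e)
                       (ℕ.+-mono-≤ (ℕ.*-monoˡ-≤ e (ℕ.<⇒≤ (n%ℕd<d x (2 ℕ.^ e)))) m≤bound)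
      ; agrees     = agrees′ }
      where
      open Approximation approx renaming (size to m; bits to γ; bits-head to γ₀; e≤size to e≤m; size≤bound to m≤bound)
      instance
        2^e≢0 : ℕ.NonZero (2 ℕ.^ e)
        2^e≢0 = ℕ.m^n≢0 2 e
      K = suc (suc L)
      p σ v w x r : ℤ
      p = pow2 (suc L)
      σ = sign K
      v∣ = flipCoeff-divisible m γ (suc L)
      w∣ = a-divisible K (s≤s (s≤s z≤n)) K≤e
      v = quotient v∣
      w = quotient w∣
      -- Coefficient K is v·2^(K−1) and must become w·2^(K−1) modulo 2^e; each block adds σ·2^(K−1)
      -- and σ² = 1, so q ≡ σ(w − v) blocks do it.
      x = σ ℤ.* (w ℤ.- v)
      q = x %ℕ (2 ℕ.^ e)
      r = x /ℕ (2 ℕ.^ e)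
      q≡ : + q ≡ x ℤ.- r ℤ.* pow2 e
      q≡ = begin
        + q                               ≡⟨ add-sub (+ q) (r ℤ.* pow2 e) ⟨
        (+ q ℤ.+ r ℤ.* pow2 e) ℤ.- r ℤ.* pow2 e ≡⟨ cong (ℤ._- r ℤ.* pow2 e) (a≡a%ℕn+[a/ℕn]*n x (2 ℕ.^ e)) ⟨
        x ℤ.- r ℤ.* pow2 e                ∎
        where
        open ≡-Reasoning
        add-sub : ∀ y z → (y ℤ.+ z) ℤ.- z ≡ y
        add-sub = solve-∀
      top : flipCoeff (blocksSize L q m) (blocks L q γ) K ℤ.- a K ≡ ℤ.- (r ℤ.* σ ℤ.* p) ℤ.* pow2 e
      top = begin
        flipCoeff (blocksSize L q m) (blocks L q γ) K ℤ.- a K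
          ≡⟨ cong₂ ℤ._-_ (flipCoeff-blocks-top L q m γ γ₀ (ℕ.≤-trans K≤e e≤m)) (_∣_.equality w∣) ⟩
        (flipCoeff m γ K ℤ.+ + q ℤ.* (σ ℤ.* p)) ℤ.- w ℤ.* p
          ≡⟨ cong₂ (λ y z → (y ℤ.+ z ℤ.* (σ ℤ.* p)) ℤ.- w ℤ.* p) (_∣_.equality v∣) q≡ ⟩
        (v ℤ.* p ℤ.+ (x ℤ.- r ℤ.* pow2 e) ℤ.* (σ ℤ.* p)) ℤ.- w ℤ.* p
          ≡⟨ expand v w p σ r (pow2 e) ⟩
        (σ ℤ.* σ ℤ.- 1ℤ) ℤ.* ((w ℤ.- v) ℤ.* p) ℤ.+ ℤ.- (r ℤ.* σ ℤ.* p) ℤ.* pow2 e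
          ≡⟨ cong (λ s → (s ℤ.- 1ℤ) ℤ.* ((w ℤ.- v) ℤ.* p) ℤ.+ ℤ.- (r ℤ.* σ ℤ.* p) ℤ.* pow2 e)
                  (sign-squared K) ⟩
        (1ℤ ℤ.- 1ℤ) ℤ.* ((w ℤ.- v) ℤ.* p) ℤ.+ ℤ.- (r ℤ.* σ ℤ.* p) ℤ.* pow2 e
          ≡⟨ ℤ.+-identityˡ _ ⟩
        ℤ.- (r ℤ.* σ ℤ.* p) ℤ.* pow2 e ∎
        where
        open ≡-Reasoning
        expand : ∀ v w p σ r P → (v ℤ.* p ℤ.+ (σ ℤ.* (w ℤ.- v) ℤ.- r ℤ.* P) ℤ.* (σ ℤ.* p)) ℤ.- w ℤ.* p
                                 ≡ (σ ℤ.* σ ℤ.- 1ℤ) ℤ.* ((w ℤ.- v) ℤ.* p) ℤ.+ ℤ.- (r ℤ.* σ ℤ.* p) ℤ.* P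
        expand = solve-∀
      agrees′ : ∀ k → K ≤ k → 2 ≤ k → k ≤ e → pow2 e ∣ flipCoeff (blocksSize L q m) (blocks L q γ) k ℤ.- a k
      agrees′ k K≤k 2≤k k≤e with ℕ.m≤n⇒m<n∨m≡n K≤k
      ... | inj₁ K<k  = subst (λ y → pow2 e ∣ y ℤ.- a k)
                              (sym (flipCoeff-blocks-above L q m γ k γ₀ K<k (ℕ.≤-trans k≤e e≤m)))
                              (agrees k K<k 2≤k k≤e)
      ... | inj₂ refl = divides (ℤ.- (r ℤ.* σ ℤ.* p)) top

    refine : ∀ K {bound} → K ≤ e → Approximation (suc K) bound → Approximation K (blockBudget e ℕ.+ bound)
    refine zero          _   = widen λ k _ 2≤k → ℕ.≤-trans (s≤s z≤n) 2≤k
    refine (suc zero)    _   = widen λ k _ 2≤k → 2≤k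
    refine (suc (suc L)) K≤e = fix-coordinate L K≤e

    approximation : ∀ d K → K ℕ.+ d ≡ suc e → Approximation K (sizeBound e d)
    approximation zero    K K+0≡e+1 = subst (λ K → Approximation K e) (trans (sym K+0≡e+1) (ℕ.+-identityʳ K)) start
    approximation (suc d) K K+d+1≡e+1 =
      refine K (subst (K ≤_) K+d≡e (ℕ.m≤m+n K d)) (approximation d (suc K) (cong suc K+d≡e))
      where
      K+d≡e : K ℕ.+ d ≡ e
      K+d≡e = ℕ.suc-injective (trans (sym (ℕ.+-suc K d)) K+d+1≡e+1)

  InRHS⇒InCU : ∀ e n t → sizeBound e (suc e) < n → InRHS e t → InCU e n t
  InRHS⇒InCU e n t N<n (a , a-divisible , a≡t) = flipMatrix n β , flipMatrix-U n β , residues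
    where
    open Construction e a (λ i 2≤i i≤e → ∣ᵤ⇒∣ (a-divisible i 2≤i i≤e)) using (module Approximation; approximation)
    open Approximation (approximation (suc e) 0 refl) renaming (size to m; bits to γ)
    β = zeros (n ∸ m) γ
    n≡ : n ∸ m ℕ.+ m ≡ n
    n≡ = ℕ.m∸n+n≡m (ℕ.≤-trans size≤bound (ℕ.<⇒≤ N<n))
    residues : SameResidues e (charCoeff n (flipMatrix n β)) t
    residues i 2≤i i≤e = ∣⇒∣ᵤ (subst (pow2 e ∣_) (telescope (charCoeff n (flipMatrix n β) i) (a i) (t i))
      (∣m∣n⇒∣m+n (subst (λ x → pow2 e ∣ x ℤ.- a i) (sym charCoeff≡) (agrees i z≤n 2≤i i≤e))
                 (∣ᵤ⇒∣ {pow2 e} {a i ℤ.- t i} (a≡t i 2≤i i≤e))))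
      where
      charCoeff≡ : charCoeff n (flipMatrix n β) i ≡ flipCoeff m γ i
      charCoeff≡ = begin
        charCoeff n (flipMatrix n β) i    ≡⟨ charCoeff-flipMatrix n β i ⟩
        flipCoeff n β i                   ≡⟨ cong (λ n → flipCoeff n β i) n≡ ⟨
        flipCoeff (n ∸ m ℕ.+ m) β i       ≡⟨ flipCoeff-zeros (n ∸ m) m γ i 2≤i (ℕ.≤-trans i≤e e≤size) ⟩
        flipCoeff m γ i                   ∎
        where open ≡-Reasoning
      telescope : ∀ x y z → (x ℤ.- y) ℤ.+ (y ℤ.- z) ≡ x ℤ.- z
      telescope = solve-∀

open Divisibility using (InCU⇒InRHS)
open Realisation using (sizeBound; InRHS⇒InCU)

theorem1p2 : (e : ℕ) → 1 ≤ e →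
    Σ ℕ λ N → (n : ℕ) → N < n →
      (t : ℕ → ℤ) → InCU e n t ⇔ InRHS e t
theorem1p2 e _ = sizeBound e (suc e) , λ n N<n t → mk⇔ (InCU⇒InRHS e n t) (InRHS⇒InCU e n t N<n)
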